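{- For every integer $t\ge 3$ and every $\varepsilon>0$ there is $n_0$ such that for all $n\ge n_0$, $$(1-\varepsilon)\frac{t!}{t^t}\binom nt\le \mathrm{ex}(n,K(t+1,2))\le (1+\varepsilon)\frac{t!}{t^t}\binom nt.$$
   Context: A simplicial complex is a pair $H=(V,E)$ with $E\subseteq\mathscr P(V)$ closed under taking subsets; all sets in $E$ (including the empty set and singletons) count as edges. $K(t,k)$ denotes the simplicial complex on $t$ vertices whose edge set is the downward closure of the complete $k$-uniform hypergraph $K_t^{(k)}$ (i.e., all subsets of size at most $k$ of a $t$-set). $H$ contains a copy of $F$ if there is an injection $\varphi:V(F)\to V(H)$ with $\varphi(e)\in E(H)$ for every $e\in E(F)$. $\mathrm{ex}(n,F)$ is the maximum number of edges of a simplicial complex on $n$ vertices containing no copy of $F$.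
   Formalization: The parameter ε ranges over the positive rationals. -}

module Defs where

open import Data.Nat using (ℕ; zero; suc; _≤_; _≤ᵇ_)
open import Data.Bool using (Bool; true; false)
open import Data.Fin using (Fin)
open import Data.Fin.Subset using (Subset; _⊆_; _∈_; ∣_∣; inside; outside)
open import Data.Vec using (_∷_; [])
open import Data.List using (List; []; _∷_; map; _++_; filter; length)
open import Data.Product using (Σ; _×_; ∃; _,_)
open import Function.Definitions using (Injective)
open import Relation.Binary.PropositionalEquality using (_≡_)
open import Relation.Nullary using (Dec; ¬_)
open import Data.Bool.Properties using (_≟_; T-≡)
open import Data.Nat.Properties using (≤ᵇ⇒≤; ≤⇒≤ᵇ; ≤-trans)
open import Data.Fin.Subset.Properties using (p⊆q⇒∣p∣≤∣q∣)
open import Function.Bundles using (Equivalence)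


record Complex (n : ℕ) : Set where
  field
    edge   : Subset n → Bool
    closed : ∀ (p q : Subset n) → p ⊆ q → edge q ≡ true → edge p ≡ true
open Complex public

allSubsets : (n : ℕ) → List (Subset n)
allSubsets zero = [] ∷ []
allSubsets (suc n) = map (inside ∷_) (allSubsets n) ++ map (outside ∷_) (allSubsets n)

-- number of edges (all sets in E, including ∅ and singletons)
numEdges : ∀ {n} → Complex n → ℕ
numEdges {n} H = length (filter (λ p → edge H p ≟ true) (allSubsets n))

IsImage : ∀ {m n} → (Fin m → Fin n) → Subset m → Subset n → Set
IsImage {m} φ e q = ∀ x → (x ∈ q → Σ (Fin m) λ i → i ∈ e × φ i ≡ x)
                        × (∀ i → i ∈ e → φ i ∈ q)

Contains : ∀ {n m} → Complex n → Complex m → Set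
Contains {n} {m} H F = Σ (Fin m → Fin n) λ φ → Injective _≡_ _≡_ φ ×
  (∀ (e : Subset m) → edge F e ≡ true → ∀ (q : Subset n) → IsImage φ e q → edge H q ≡ true)

K : (t k : ℕ) → Complex t
K t k = record { edge = λ p → ∣ p ∣ ≤ᵇ k ; closed = closedK }
  where
    closedK : ∀ (p q : Subset t) → p ⊆ q → (∣ q ∣ ≤ᵇ k) ≡ true → (∣ p ∣ ≤ᵇ k) ≡ true
    closedK p q p⊆q h = Equivalence.to T-≡
      (≤⇒≤ᵇ (≤-trans (p⊆q⇒∣p∣≤∣q∣ p⊆q) (≤ᵇ⇒≤ ∣ q ∣ k (Equivalence.from T-≡ h))))

IsEx : ∀ {k} → (n : ℕ) → Complex k → ℕ → Set
IsEx n F m = (Σ (Complex n) λ H → ¬ Contains H F × numEdges H ≡ m)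
           × (∀ (H : Complex n) → ¬ Contains H F → numEdges H ≤ m)

-- A complex contains K(t+1,2) exactly when its 1-skeleton has a (t+1)-clique, so the question is how many faces a
-- complex can have without such a clique. On m vertices the answer is maxFaces t m, the maximum over Δ ≤ m of
-- (m − Δ + 1) · maxFaces (t − 1) Δ. For the upper bound let A be the neighbourhood of a vertex of maximum degree Δ:
-- A has no t-clique, and deleting the m − Δ vertices outside A one at a time removes each time only the faces of a
-- link living in a neighbourhood of size at most Δ, again without a t-clique. Joining an optimal complex on Δ vertices
-- with m − Δ independent vertices attains the bound (this iterates to the clique complex of a Turán graph), so
-- ex(n, K(t+1,2)) = maxFaces t n. Weighted AM–GM then gives n^t ≤ t^t · maxFaces t n ≤ (n + t)^t, while
-- (n − t)^t ≤ t! C(n,t) ≤ n^t.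

module Submission where

module Subsets where

  open import Data.Nat using (ℕ; zero; suc; _+_; _≤_; z≤n; s≤s; _≤?_)
  open import Data.Nat.Properties hiding (_≟_)
  open import Data.Bool using (true; false; not)
  open import Data.Vec using ([]; _∷_; here; there; tabulate)
  open import Data.Vec.Properties using (lookup∘tabulate; []=⇒lookup; lookup⇒[]=)
  open import Data.Fin using (Fin; zero; suc; _≟_)
  open import Data.Fin.Subset
  open import Data.Fin.Subset.Properties
  open import Data.Fin.Properties using (any?)
  open import Data.List using (List; []; _∷_; allFin)
  open import Data.List.Membership.Propositional using () renaming (_∈_ to _∈ₗ_)
  open import Data.List.Membership.Propositional.Properties using (∈-allFin)
  open import Data.List.Relation.Unary.Any using (here; there)
  open import Data.Product using (Σ; ∃; _×_; _,_)
  open import Data.Sum using (_⊎_; inj₁; inj₂)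
  open import Function using (_∘_)
  open import Relation.Nullary using (Dec; yes; no; does; contradiction)
  open import Relation.Nullary.Decidable using (dec-true; _×-dec_; ¬?)
  open import Relation.Unary using (Decidable)
  open import Relation.Binary.PropositionalEquality

  does-true⁻ : ∀ {A : Set} (a? : Dec A) → does a? ≡ true → A
  does-true⁻ (yes a) _ = a
  does-true⁻ (no _) ()

  subsetOf : ∀ {n} {P : Fin n → Set} → Decidable P → Subset n
  subsetOf P? = tabulate (does ∘ P?)

  ∈-subsetOf⁺ : ∀ {n} {P : Fin n → Set} (P? : Decidable P) {x} → P x → x ∈ subsetOf P?
  ∈-subsetOf⁺ P? {x} px = lookup⇒[]= x _ (trans (lookup∘tabulate (does ∘ P?) x) (dec-true (P? x) px))

  ∈-subsetOf⁻ : ∀ {n} {P : Fin n → Set} (P? : Decidable P) {x} → x ∈ subsetOf P? → P x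
  ∈-subsetOf⁻ P? {x} x∈ = does-true⁻ (P? x) (trans (sym (lookup∘tabulate (does ∘ P?) x)) ([]=⇒lookup x∈))

  toggle : ∀ {n} → Fin n → Subset n → Subset n
  toggle zero    (s ∷ p) = not s ∷ p
  toggle (suc y) (s ∷ p) = s ∷ toggle y p

  y∈toggle⇒y∉p : ∀ {n} (y : Fin n) p → y ∈ toggle y p → y ∉ p
  y∈toggle⇒y∉p zero    (true  ∷ p) () here
  y∈toggle⇒y∉p zero    (false ∷ p) _  ()
  y∈toggle⇒y∉p (suc y) (s ∷ p) (there y∈) (there y∈p) = y∈toggle⇒y∉p y p y∈ y∈p

  y∉p⇒y∈toggle : ∀ {n} (y : Fin n) p → y ∉ p → y ∈ toggle y p
  y∉p⇒y∈toggle zero    (true  ∷ p) y∉p = contradiction here y∉p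
  y∉p⇒y∈toggle zero    (false ∷ p) _   = here
  y∉p⇒y∈toggle (suc y) (s ∷ p)     y∉p = there (y∉p⇒y∈toggle y p (y∉p ∘ there))

  x∈toggle⇒x∈p : ∀ {n} {x : Fin n} (y : Fin n) p → x ≢ y → x ∈ toggle y p → x ∈ p
  x∈toggle⇒x∈p {x = zero}  zero    p       x≢y _           = contradiction refl x≢y
  x∈toggle⇒x∈p {x = suc x} zero    (s ∷ p) _   (there x∈)  = there x∈
  x∈toggle⇒x∈p {x = zero}  (suc y) (s ∷ p) _   here        = here
  x∈toggle⇒x∈p {x = suc x} (suc y) (s ∷ p) x≢y (there x∈) = there (x∈toggle⇒x∈p y p (x≢y ∘ cong suc) x∈)

  x∈p⇒x∈toggle : ∀ {n} {x : Fin n} (y : Fin n) p → x ≢ y → x ∈ p → x ∈ toggle y p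
  x∈p⇒x∈toggle {x = zero}  zero    p       x≢y _           = contradiction refl x≢y
  x∈p⇒x∈toggle {x = suc x} zero    (s ∷ p) _   (there x∈p) = there x∈p
  x∈p⇒x∈toggle {x = zero}  (suc y) (s ∷ p) _   here        = here
  x∈p⇒x∈toggle {x = suc x} (suc y) (s ∷ p) x≢y (there x∈p) = there (x∈p⇒x∈toggle y p (x≢y ∘ cong suc) x∈p)

  x∈p─q⇒x∉q : ∀ {n} {x : Fin n} (p q : Subset n) → x ∈ p ─ q → x ∉ q
  x∈p─q⇒x∉q {x = zero}  (s ∷ p) (true  ∷ q) ()
  x∈p─q⇒x∉q {x = zero}  (s ∷ p) (false ∷ q) _          ()
  x∈p─q⇒x∉q {x = suc x} (s ∷ p) (r ∷ q)     (there x∈) (there x∈q) = x∈p─q⇒x∉q p q x∈ x∈q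

  p⊆q⇒p∩r⊆q∩r : ∀ {n} {p q : Subset n} (r : Subset n) → p ⊆ q → p ∩ r ⊆ q ∩ r
  p⊆q⇒p∩r⊆q∩r {p = p} r p⊆q x∈ with x∈p∩q⁻ p r x∈
  ... | x∈p , x∈r = x∈p∩q⁺ (p⊆q x∈p , x∈r)

  p⊆q⇒p∪r⊆q∪r : ∀ {n} {p q : Subset n} (r : Subset n) → p ⊆ q → p ∪ r ⊆ q ∪ r
  p⊆q⇒p∪r⊆q∪r {p = p} r p⊆q x∈ with x∈p∪q⁻ p r x∈
  ... | inj₁ x∈p = x∈p∪q⁺ (inj₁ (p⊆q x∈p))
  ... | inj₂ x∈r = x∈p∪q⁺ (inj₂ x∈r)

  x∈p⇒∣p∣≡1+∣p-x∣ : ∀ {n} {x : Fin n} (p : Subset n) → x ∈ p → ∣ p ∣ ≡ suc ∣ p - x ∣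
  x∈p⇒∣p∣≡1+∣p-x∣ {x = zero}  (true  ∷ p) here       = cong (suc ∘ ∣_∣) (sym (p─⊥≡p p))
  x∈p⇒∣p∣≡1+∣p-x∣ {x = suc x} (true  ∷ p) (there x∈) = cong suc (x∈p⇒∣p∣≡1+∣p-x∣ p x∈)
  x∈p⇒∣p∣≡1+∣p-x∣ {x = suc x} (false ∷ p) (there x∈) = x∈p⇒∣p∣≡1+∣p-x∣ p x∈

  ∣p∪q∣≤∣p∣+∣q∣ : ∀ {n} (p q : Subset n) → ∣ p ∪ q ∣ ≤ ∣ p ∣ + ∣ q ∣
  ∣p∪q∣≤∣p∣+∣q∣ []          []          = z≤n
  ∣p∪q∣≤∣p∣+∣q∣ (true  ∷ p) (true  ∷ q) = s≤s (≤-trans (∣p∪q∣≤∣p∣+∣q∣ p q) (+-monoʳ-≤ ∣ p ∣ (n≤1+n ∣ q ∣)))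
  ∣p∪q∣≤∣p∣+∣q∣ (true  ∷ p) (false ∷ q) = s≤s (∣p∪q∣≤∣p∣+∣q∣ p q)
  ∣p∪q∣≤∣p∣+∣q∣ (false ∷ p) (true  ∷ q) = ≤-trans (s≤s (∣p∪q∣≤∣p∣+∣q∣ p q)) (≤-reflexive (sym (+-suc ∣ p ∣ ∣ q ∣)))
  ∣p∪q∣≤∣p∣+∣q∣ (false ∷ p) (false ∷ q) = ∣p∪q∣≤∣p∣+∣q∣ p q

  pair : ∀ {n} → Fin n → Fin n → Subset n
  pair x y = ⁅ x ⁆ ∪ ⁅ y ⁆

  x∈pair : ∀ {n} (x y : Fin n) → x ∈ pair x y
  x∈pair x y = x∈p∪q⁺ (inj₁ (x∈⁅x⁆ x))

  y∈pair : ∀ {n} (x y : Fin n) → y ∈ pair x y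
  y∈pair x y = x∈p∪q⁺ (inj₂ (x∈⁅x⁆ y))

  ∈pair⇒≡⊎≡ : ∀ {n} {x y z : Fin n} → z ∈ pair x y → z ≡ x ⊎ z ≡ y
  ∈pair⇒≡⊎≡ {x = x} {y} z∈ with x∈p∪q⁻ ⁅ x ⁆ ⁅ y ⁆ z∈
  ... | inj₁ z∈⁅x⁆ = inj₁ (x∈⁅y⁆⇒x≡y x z∈⁅x⁆)
  ... | inj₂ z∈⁅y⁆ = inj₂ (x∈⁅y⁆⇒x≡y y z∈⁅y⁆)

  pair⊆ : ∀ {n} {x y : Fin n} {p : Subset n} → x ∈ p → y ∈ p → pair x y ⊆ p
  pair⊆ x∈p y∈p z∈ with ∈pair⇒≡⊎≡ z∈
  ... | inj₁ refl = x∈p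
  ... | inj₂ refl = y∈p

  ∣pair∣≤2 : ∀ {n} (x y : Fin n) → ∣ pair x y ∣ ≤ 2
  ∣pair∣≤2 x y = ≤-trans (∣p∪q∣≤∣p∣+∣q∣ ⁅ x ⁆ ⁅ y ⁆) (≤-reflexive (cong₂ _+_ (∣⁅x⁆∣≡1 x) (∣⁅x⁆∣≡1 y)))

  x∈p⇒1≤∣p∣ : ∀ {n} {x : Fin n} {p : Subset n} → x ∈ p → 1 ≤ ∣ p ∣
  x∈p⇒1≤∣p∣ x∈p = ≤-trans (s≤s z≤n) (x∈p⇒∣p-x∣<∣p∣ x∈p)

  x≢y⇒2≤∣p∣ : ∀ {n} {x y : Fin n} {p : Subset n} → x ≢ y → x ∈ p → y ∈ p → 2 ≤ ∣ p ∣
  x≢y⇒2≤∣p∣ {x = x} {y} x≢y x∈p y∈p =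
    subst (λ k → suc k ≤ _) (∣⁅x⁆∣≡1 x)
      (p⊂q⇒∣p∣<∣q∣ ((λ z∈ → subst (_∈ _) (sym (x∈⁅y⁆⇒x≡y x z∈)) x∈p) , y , y∈p , x≢y ∘ sym ∘ x∈⁅y⁆⇒x≡y x))

  ∣p∣≤2⇒p⊆pair : ∀ {n} (p : Subset (suc n)) → ∣ p ∣ ≤ 2 → ∃ λ x → ∃ λ y → p ⊆ pair x y
  ∣p∣≤2⇒p⊆pair p ∣p∣≤2 with nonempty? p
  ... | no p-empty = zero , zero , λ z∈ → contradiction (_ , z∈) p-empty
  ... | yes (x , x∈p) with nonempty? (p - x)
  ...   | no p-x-empty = x , x , p⊆pair-x-x
    where
    p⊆pair-x-x : p ⊆ pair x x
    p⊆pair-x-x {z} z∈p with z ≟ x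
    ... | yes refl = x∈pair x x
    ... | no z≢x  = contradiction (z , x∈p∧x≢y⇒x∈p-y z∈p z≢x) p-x-empty
  ...   | yes (y , y∈p-x) = x , y , p⊆pair-x-y
    where
    ∣p-x-y∣≤0 : ∣ p - x - y ∣ ≤ 0
    ∣p-x-y∣≤0 = ≤-pred (≤-trans (x∈p⇒∣p-x∣<∣p∣ y∈p-x) (≤-pred (≤-trans (x∈p⇒∣p-x∣<∣p∣ x∈p) ∣p∣≤2)))
    p⊆pair-x-y : p ⊆ pair x y
    p⊆pair-x-y {z} z∈p with z ≟ x | z ≟ y
    ... | yes refl | _        = x∈pair x y
    ... | no _     | yes refl = y∈pair x y
    ... | no z≢x   | no z≢y   =
      contradiction ∣p-x-y∣≤0 (<⇒≱ (x∈p⇒1≤∣p∣ (x∈p∧x≢y⇒x∈p-y (x∈p∧x≢y⇒x∈p-y z∈p z≢x) z≢y)))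

  subsetOfSize : ∀ {n} (S : Subset n) {d} → d ≤ ∣ S ∣ → Σ (Subset n) λ X → X ⊆ S × ∣ X ∣ ≡ d
  subsetOfSize {n} S           {zero}  _ = ⊥ , ⊥⊆ , ∣⊥∣≡0 n
  subsetOfSize (true  ∷ S) {suc d} (s≤s d≤) with subsetOfSize S d≤
  ... | X , X⊆S , ∣X∣≡d = inside ∷ X , s⊆s X⊆S , cong suc ∣X∣≡d
  subsetOfSize (false ∷ S) {suc d} d≤ with subsetOfSize S d≤
  ... | X , X⊆S , ∣X∣≡d = outside ∷ X , out⊆ X⊆S , ∣X∣≡d

  p⊆q⊎∃p─q : ∀ {n} (p q : Subset n) → p ⊆ q ⊎ ∃ λ y → y ∈ p × y ∉ q
  p⊆q⊎∃p─q p q with any? (λ y → (y ∈? p) ×-dec ¬? (y ∈? q))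
  ... | yes witness = inj₂ witness
  ... | no none = inj₁ p⊆q
    where
    p⊆q : p ⊆ q
    p⊆q {y} y∈p with y ∈? q
    ... | yes y∈q = y∈q
    ... | no y∉q  = contradiction (y , y∈p , y∉q) none

  argmaxOn : ∀ {n} (f : Fin n → ℕ) (S : Subset n) {v} → v ∈ S →
             ∃ λ w → w ∈ S × (∀ {x} → x ∈ S → f x ≤ f w)
  argmaxOn {n} f S {v} v∈S with go (allFin n) v∈S
    where
    go : ∀ (xs : List (Fin n)) {w} → w ∈ S →
         ∃ λ w′ → w′ ∈ S × f w ≤ f w′ × (∀ {x} → x ∈ S → x ∈ₗ xs → f x ≤ f w′)
    go []       {w} w∈S = w , w∈S , ≤-refl , λ _ ()
    go (x ∷ xs) {w} w∈S with x ∈? S | f w ≤? f x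
    ... | yes x∈S | yes fw≤fx with go xs x∈S
    ...   | w′ , w′∈S , fx≤ , max = w′ , w′∈S , ≤-trans fw≤fx fx≤ ,
            λ { _ (here refl) → fx≤ ; z∈S (there z∈xs) → max z∈S z∈xs }
    go (x ∷ xs) {w} w∈S | yes _ | no fw≰fx with go xs w∈S
    ...   | w′ , w′∈S , fw≤ , max = w′ , w′∈S , fw≤ ,
            λ { _ (here refl) → ≤-trans (<⇒≤ (≰⇒> fw≰fx)) fw≤ ; z∈S (there z∈xs) → max z∈S z∈xs }
    go (x ∷ xs) {w} w∈S | no x∉S | _ with go xs w∈S
    ...   | w′ , w′∈S , fw≤ , max = w′ , w′∈S , fw≤ ,
            λ { x∈S (here refl) → contradiction x∈S x∉S ; z∈S (there z∈xs) → max z∈S z∈xs }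
  ... | w , w∈S , _ , max = w , w∈S , λ x∈S → max x∈S (∈-allFin _)

module Counting where

  open import Data.Nat using (ℕ; zero; suc; _+_; _≤_; z≤n; s≤s)
  open import Data.Nat.Properties
  open import Data.Bool using (true; false)
  open import Data.Vec using ([]; _∷_; tail)
  open import Data.Fin using (Fin; zero; suc)
  open import Data.Fin.Subset using (Subset; inside; outside)
  open import Data.List using ([]; _∷_; _++_; map; filter; length)
  open import Data.List.Properties using (length-++; filter-++)
  open import Data.Sum using (_⊎_; inj₁; inj₂)
  open import Relation.Nullary using (yes; no; ¬_; does; contradiction)
  open import Relation.Unary using (Decidable)
  open import Relation.Binary.PropositionalEquality
  open import Function using (_∘_)
  open import Algebra.Properties.CommutativeSemigroup +-commutativeSemigroup using (interchange)
  open import Defs using (allSubsets)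
  open Subsets using (toggle)

  count : ∀ {n} {P : Subset n → Set} → Decidable P → ℕ
  count {zero}  P? with P? []
  ... | yes _ = 1
  ... | no _  = 0
  count {suc n} P? = count (P? ∘ (inside ∷_)) + count (P? ∘ (outside ∷_))

  count-mono : ∀ {n} {P Q : Subset n → Set} (P? : Decidable P) (Q? : Decidable Q) →
               (∀ p → P p → Q p) → count P? ≤ count Q?
  count-mono {zero} P? Q? P⇒Q with P? [] | Q? []
  ... | yes _  | yes _  = ≤-refl
  ... | yes Pp | no ¬Qp = contradiction (P⇒Q [] Pp) ¬Qp
  ... | no _   | _      = z≤n
  count-mono {suc n} P? Q? P⇒Q =
    +-mono-≤ (count-mono (P? ∘ (inside ∷_))  (Q? ∘ (inside ∷_))  (P⇒Q ∘ (inside ∷_)))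
             (count-mono (P? ∘ (outside ∷_)) (Q? ∘ (outside ∷_)) (P⇒Q ∘ (outside ∷_)))

  count-⊎ : ∀ {n} {P Q R : Subset n → Set} (P? : Decidable P) (Q? : Decidable Q) (R? : Decidable R) →
            (∀ p → P p → Q p ⊎ R p) → count P? ≤ count Q? + count R?
  count-⊎ {zero} P? Q? R? P⇒Q⊎R with P? [] | Q? [] | R? []
  ... | no _  | _     | _     = z≤n
  ... | yes _ | yes _ | _     = s≤s z≤n
  ... | yes _ | no _  | yes _ = s≤s z≤n
  ... | yes Pp | no ¬Qp | no ¬Rp with P⇒Q⊎R [] Pp
  ...   | inj₁ Qp = contradiction Qp ¬Qp
  ...   | inj₂ Rp = contradiction Rp ¬Rp
  count-⊎ {suc n} P? Q? R? P⇒Q⊎R =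
    ≤-trans (+-mono-≤ (count-⊎ (P? ∘ (inside ∷_)) (Q? ∘ (inside ∷_)) (R? ∘ (inside ∷_)) (P⇒Q⊎R ∘ (inside ∷_)))
                      (count-⊎ (P? ∘ (outside ∷_)) (Q? ∘ (outside ∷_)) (R? ∘ (outside ∷_)) (P⇒Q⊎R ∘ (outside ∷_))))
            (≤-reflexive (interchange (count (Q? ∘ (inside ∷_))) (count (R? ∘ (inside ∷_)))
                                      (count (Q? ∘ (outside ∷_))) (count (R? ∘ (outside ∷_)))))

  count-disjoint : ∀ {n} {P Q R : Subset n → Set} (P? : Decidable P) (Q? : Decidable Q) (R? : Decidable R) →
                   (∀ p → Q p → P p) → (∀ p → R p → P p) → (∀ p → Q p → ¬ R p) →
                   count Q? + count R? ≤ count P?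
  count-disjoint {zero} P? Q? R? Q⇒P R⇒P Q⇒¬R with P? [] | Q? [] | R? []
  ... | _      | no _  | no _  = z≤n
  ... | yes _  | yes _ | no _  = s≤s z≤n
  ... | yes _  | no _  | yes _ = s≤s z≤n
  ... | _      | yes Qp | yes Rp = contradiction Rp (Q⇒¬R [] Qp)
  ... | no ¬Pp | yes Qp | no _   = contradiction (Q⇒P [] Qp) ¬Pp
  ... | no ¬Pp | no _   | yes Rp = contradiction (R⇒P [] Rp) ¬Pp
  count-disjoint {suc n} P? Q? R? Q⇒P R⇒P Q⇒¬R =
    ≤-trans (≤-reflexive (interchange (count (Q? ∘ (inside ∷_))) (count (Q? ∘ (outside ∷_)))
                                      (count (R? ∘ (inside ∷_))) (count (R? ∘ (outside ∷_)))))
            (+-mono-≤ (count-disjoint (P? ∘ (inside ∷_)) (Q? ∘ (inside ∷_)) (R? ∘ (inside ∷_))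
                         (Q⇒P ∘ (inside ∷_)) (R⇒P ∘ (inside ∷_)) (Q⇒¬R ∘ (inside ∷_)))
                      (count-disjoint (P? ∘ (outside ∷_)) (Q? ∘ (outside ∷_)) (R? ∘ (outside ∷_))
                         (Q⇒P ∘ (outside ∷_)) (R⇒P ∘ (outside ∷_)) (Q⇒¬R ∘ (outside ∷_))))

  count-toggle : ∀ {n} {P : Subset n → Set} (y : Fin n) (P? : Decidable P) →
                 count (λ p → P? (toggle y p)) ≡ count P?
  count-toggle {suc n} zero    P? = +-comm (count (P? ∘ (outside ∷_))) (count (P? ∘ (inside ∷_)))
  count-toggle {suc n} (suc y) P? =
    cong₂ _+_ (count-toggle y (P? ∘ (inside ∷_))) (count-toggle y (P? ∘ (outside ∷_)))

  count-≡0 : ∀ {n} {P : Subset n → Set} (P? : Decidable P) → (∀ p → ¬ P p) → count P? ≡ 0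
  count-≡0 {zero} P? ¬P with P? []
  ... | yes Pp = contradiction Pp (¬P [])
  ... | no _   = refl
  count-≡0 {suc n} P? ¬P =
    cong₂ _+_ (count-≡0 (P? ∘ (inside ∷_))  (¬P ∘ (inside ∷_)))
              (count-≡0 (P? ∘ (outside ∷_)) (¬P ∘ (outside ∷_)))

  count-≤1 : ∀ {n} {P : Subset n → Set} (P? : Decidable P) (q : Subset n) →
             (∀ p → P p → p ≡ q) → count P? ≤ 1
  count-≤1 {zero} P? [] _ with P? []
  ... | yes _ = ≤-refl
  ... | no _  = z≤n
  count-≤1 {suc n} P? (true ∷ q) P⇒≡q = begin
    count (P? ∘ (inside ∷_)) + count (P? ∘ (outside ∷_))
      ≡⟨ cong (count (P? ∘ (inside ∷_)) +_) (count-≡0 (P? ∘ (outside ∷_)) λ p Pp → case (P⇒≡q _ Pp)) ⟩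
    count (P? ∘ (inside ∷_)) + 0
      ≡⟨ +-identityʳ _ ⟩
    count (P? ∘ (inside ∷_))
      ≤⟨ count-≤1 (P? ∘ (inside ∷_)) q (λ p Pp → cong tail (P⇒≡q _ Pp)) ⟩
    1 ∎
    where
    open ≤-Reasoning
    case : ∀ {p : Subset n} → outside ∷ p ≢ inside ∷ q
    case ()
  count-≤1 {suc n} P? (false ∷ q) P⇒≡q = begin
    count (P? ∘ (inside ∷_)) + count (P? ∘ (outside ∷_))
      ≡⟨ cong (_+ count (P? ∘ (outside ∷_))) (count-≡0 (P? ∘ (inside ∷_)) λ p Pp → case (P⇒≡q _ Pp)) ⟩
    count (P? ∘ (outside ∷_))
      ≤⟨ count-≤1 (P? ∘ (outside ∷_)) q (λ p Pp → cong tail (P⇒≡q _ Pp)) ⟩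
    1 ∎
    where
    open ≤-Reasoning
    case : ∀ {p : Subset n} → inside ∷ p ≢ outside ∷ q
    case ()

  count-≥1 : ∀ {n} {P : Subset n → Set} (P? : Decidable P) {q : Subset n} → P q → 1 ≤ count P?
  count-≥1 {zero} P? {[]} Pq with P? []
  ... | yes _  = ≤-refl
  ... | no ¬Pq = contradiction Pq ¬Pq
  count-≥1 {suc n} P? {true  ∷ q} Pq = ≤-trans (count-≥1 (P? ∘ (inside ∷_)) Pq) (m≤m+n _ _)
  count-≥1 {suc n} P? {false ∷ q} Pq = ≤-trans (count-≥1 (P? ∘ (outside ∷_)) Pq) (m≤n+m _ _)

  private
    length-filter-map : ∀ {A B : Set} {P : B → Set} (P? : Decidable P) (f : A → B) xs →
                        length (filter P? (map f xs)) ≡ length (filter (λ a → P? (f a)) xs)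
    length-filter-map P? f []       = refl
    length-filter-map P? f (x ∷ xs) with does (P? (f x))
    ... | true  = cong suc (length-filter-map P? f xs)
    ... | false = length-filter-map P? f xs

  length-filter-allSubsets : ∀ {n} {P : Subset n → Set} (P? : Decidable P) →
                             length (filter P? (allSubsets n)) ≡ count P?
  length-filter-allSubsets {zero} P? with P? []
  ... | yes _ = refl
  ... | no _  = refl
  length-filter-allSubsets {suc n} P? = begin
    length (filter P? (map (inside ∷_) (allSubsets n) ++ map (outside ∷_) (allSubsets n)))
      ≡⟨ cong length (filter-++ P? (map (inside ∷_) (allSubsets n)) (map (outside ∷_) (allSubsets n))) ⟩
    length (filter P? (map (inside ∷_) (allSubsets n)) ++ filter P? (map (outside ∷_) (allSubsets n)))
      ≡⟨ length-++ (filter P? (map (inside ∷_) (allSubsets n))) ⟩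
    length (filter P? (map (inside ∷_) (allSubsets n))) + length (filter P? (map (outside ∷_) (allSubsets n)))
      ≡⟨ cong₂ _+_ (length-filter-map P? (inside ∷_) (allSubsets n)) (length-filter-map P? (outside ∷_) (allSubsets n)) ⟩
    length (filter (P? ∘ (inside ∷_)) (allSubsets n)) + length (filter (P? ∘ (outside ∷_)) (allSubsets n))
      ≡⟨ cong₂ _+_ (length-filter-allSubsets (P? ∘ (inside ∷_))) (length-filter-allSubsets (P? ∘ (outside ∷_))) ⟩
    count (P? ∘ (inside ∷_)) + count (P? ∘ (outside ∷_)) ∎
    where open ≡-Reasoning

module MaxFaces where

  open import Data.Nat using (ℕ; zero; suc; _*_; _∸_; _⊔_; _≤_; z≤n; s≤s)
  open import Data.Nat.Properties
  open import Data.Product using (∃; _×_; _,_)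
  open import Data.Sum using (inj₁; inj₂)
  open import Relation.Binary.PropositionalEquality

  maxUpTo : (ℕ → ℕ) → ℕ → ℕ
  maxUpTo f zero    = f zero
  maxUpTo f (suc k) = maxUpTo f k ⊔ f (suc k)

  ≤-maxUpTo : ∀ f {k Δ} → Δ ≤ k → f Δ ≤ maxUpTo f k
  ≤-maxUpTo f {zero}  z≤n = ≤-refl
  ≤-maxUpTo f {suc k} Δ≤1+k with m≤n⇒m<n∨m≡n Δ≤1+k
  ... | inj₁ (s≤s Δ≤k) = ≤-trans (≤-maxUpTo f Δ≤k) (m≤m⊔n _ _)
  ... | inj₂ refl      = m≤n⊔m _ _

  maxUpTo-attained : ∀ f k → ∃ λ Δ → Δ ≤ k × maxUpTo f k ≡ f Δ
  maxUpTo-attained f zero = zero , z≤n , refl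
  maxUpTo-attained f (suc k) with maxUpTo-attained f k | ≤-total (maxUpTo f k) (f (suc k))
  ... | _ , _ , _      | inj₁ ≤f = suc k , ≤-refl , m≤n⇒m⊔n≡n ≤f
  ... | Δ , Δ≤k , ≡fΔ | inj₂ ≥f = Δ , m≤n⇒m≤1+n Δ≤k , trans (m≥n⇒m⊔n≡m ≥f) ≡fΔ

  joinCount : (ℕ → ℕ) → ℕ → ℕ → ℕ
  joinCount h m Δ = suc (m ∸ Δ) * h Δ

  maxFaces : ℕ → ℕ → ℕ
  maxFaces zero    m = 1
  maxFaces (suc t) m = maxUpTo (joinCount (maxFaces t) m) m

  joinCount≤maxFaces : ∀ t {m Δ} → Δ ≤ m → joinCount (maxFaces t) m Δ ≤ maxFaces (suc t) m
  joinCount≤maxFaces t = ≤-maxUpTo (joinCount (maxFaces t) _)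

  maxFaces-attained : ∀ t m → ∃ λ Δ → Δ ≤ m × maxFaces (suc t) m ≡ joinCount (maxFaces t) m Δ
  maxFaces-attained t m = maxUpTo-attained (joinCount (maxFaces t) m) m

  maxFaces-mono : ∀ t {m m′} → m ≤ m′ → maxFaces t m ≤ maxFaces t m′
  maxFaces-mono zero    _ = ≤-refl
  maxFaces-mono (suc t) {m} {m′} m≤m′ with maxFaces-attained t m
  ... | Δ , Δ≤m , ≡joinCount = begin
    maxFaces (suc t) m              ≡⟨ ≡joinCount ⟩
    suc (m ∸ Δ) * maxFaces t Δ      ≤⟨ *-monoˡ-≤ (maxFaces t Δ) (s≤s (∸-monoˡ-≤ Δ m≤m′)) ⟩
    joinCount (maxFaces t) m′ Δ     ≤⟨ joinCount≤maxFaces t (≤-trans Δ≤m m≤m′) ⟩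
    maxFaces (suc t) m′             ∎
    where open ≤-Reasoning

module Estimates where

  open import Data.Nat using (zero; suc; _+_; _*_; _∸_; _^_; _≤_; NonZero; _/_; _%_)
  open import Data.Nat.Properties
  open import Data.Nat.DivMod using (m≡m%n+[m/n]*n; m%n<n)
  open import Data.Product using (∃; _×_; _,_)
  open import Data.Sum using (inj₁; inj₂)
  open import Relation.Binary.PropositionalEquality
  open import Data.Nat.Solver using (module +-*-Solver)
  open +-*-Solver
  open MaxFaces

  [m*n]^k≡m^k*n^k : ∀ m n k → (m * n) ^ k ≡ m ^ k * n ^ k
  [m*n]^k≡m^k*n^k m n zero    = refl
  [m*n]^k≡m^k*n^k m n (suc k) = trans (cong (m * n *_) ([m*n]^k≡m^k*n^k m n k))
    (solve 4 (λ m n x y → (m :* n) :* (x :* y) := (m :* x) :* (n :* y)) refl m n (m ^ k) (n ^ k))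

  n^n≢0 : ∀ n → NonZero (n ^ n)
  n^n≢0 zero    = _
  n^n≢0 (suc n) = m^n≢0 (suc n) (suc n)

  rearrangement : ∀ {a b A B} → a ≤ b → A ≤ B → A * b + a * B ≤ A * a + B * b
  rearrangement {a} {A = A} a≤b A≤B with m≤n⇒∃[o]m+o≡n a≤b | m≤n⇒∃[o]m+o≡n A≤B
  ... | d , refl | e , refl =
    ≤-trans (m≤m+n _ (d * e))
      (≤-reflexive (solve 4 (λ a d A e → (A :* (a :+ d) :+ a :* (A :+ e)) :+ d :* e
                                        := A :* a :+ (A :+ e) :* (a :+ d)) refl a d A e))

  rearrangement-^ : ∀ u v n → u ^ n * v + u * v ^ n ≤ u ^ n * u + v ^ n * v
  rearrangement-^ u v n with ≤-total u v
  ... | inj₁ u≤v = rearrangement u≤v (^-monoˡ-≤ n u≤v)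
  ... | inj₂ v≤u = begin
    u ^ n * v + u * v ^ n   ≡⟨ solve 4 (λ u v U V → U :* v :+ u :* V := V :* u :+ v :* U) refl u v (u ^ n) (v ^ n) ⟩
    v ^ n * u + v * u ^ n   ≤⟨ rearrangement v≤u (^-monoˡ-≤ n v≤u) ⟩
    v ^ n * v + u ^ n * u   ≡⟨ +-comm (v ^ n * v) (u ^ n * u) ⟩
    u ^ n * u + v ^ n * v   ∎
    where open ≤-Reasoning

  -- Weighted AM–GM for the weights 1 and r, cleared of denominators.
  amgm-weighted : ∀ r u v → suc r * u * v ^ r ≤ u ^ suc r + r * v ^ suc r
  amgm-weighted zero u v =
    ≤-reflexive (solve 2 (λ u v → (con 1 :* u) :* con 1 := u :* con 1 :+ con 0 :* (v :* con 1)) refl u v)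
  amgm-weighted (suc r) u v = begin
    suc (suc r) * u * (v * V)   ≡⟨ solve 4 (λ r u v V → (con 2 :+ r) :* u :* (v :* V)
                                                := ((con 1 :+ r) :* u :* V) :* v :+ u :* (v :* V)) refl r u v V ⟩
    (suc r * u * V) * v + u * B ≤⟨ +-monoˡ-≤ (u * B) (*-monoˡ-≤ v (amgm-weighted r u v)) ⟩
    (A + r * B) * v + u * B     ≡⟨ solve 5 (λ A B u v r → (A :+ r :* B) :* v :+ u :* B
                                                := r :* B :* v :+ (A :* v :+ u :* B)) refl A B u v r ⟩
    r * B * v + (A * v + u * B) ≤⟨ +-monoʳ-≤ (r * B * v) (rearrangement-^ u v (suc r)) ⟩
    r * B * v + (A * u + B * v) ≡⟨ solve 5 (λ A B u v r → r :* B :* v :+ (A :* u :+ B :* v)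
                                                := u :* A :+ (con 1 :+ r) :* (v :* B)) refl A B u v r ⟩
    u * A + suc r * (v * B)     ∎
    where
    open ≤-Reasoning
    V = v ^ r
    A = u ^ suc r
    B = v ^ suc r

  -- x (y/t)^t ≤ ((x+y)/(t+1))^(t+1), cleared of denominators.
  amgm : ∀ t x y → suc t ^ suc t * x * y ^ t ≤ t ^ t * (x + y) ^ suc t
  amgm zero x y = begin
    (1 * 1) * x * 1     ≡⟨ solve 1 (λ x → (con 1 :* con 1) :* x :* con 1 := x) refl x ⟩
    x                   ≤⟨ m≤m+n x y ⟩
    x + y               ≡⟨ solve 2 (λ x y → x :+ y := con 1 :* ((x :+ y) :* con 1)) refl x y ⟩
    1 * ((x + y) * 1)   ∎
    where open ≤-Reasoning
  amgm t@(suc _) x y = *-cancelˡ-≤ t (begin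
    t * (suc t ^ suc t * x * y ^ t)    ≡⟨ solve 5 (λ t P x Y T → t :* ((T :* P) :* x :* Y) := t :* (T :* x) :* (P :* Y))
                                               refl t (suc t ^ t) x (y ^ t) (suc t) ⟩
    t * (suc t * x) * (suc t ^ t * y ^ t) ≡⟨ cong (t * (suc t * x) *_) (sym ([m*n]^k≡m^k*n^k (suc t) y t)) ⟩
    t * (suc t * x) * V ^ t            ≤⟨ +-cancelʳ-≤ (t * V ^ suc t) _ _ (subst (_≤ M ^ suc t + t * V ^ suc t) split
                                               (amgm-weighted t M V)) ⟩
    M ^ suc t                          ≡⟨ [m*n]^k≡m^k*n^k t (x + y) (suc t) ⟩
    t ^ suc t * (x + y) ^ suc t        ≡⟨ *-assoc t (t ^ t) _ ⟩
    t * (t ^ t * (x + y) ^ suc t)      ∎)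
    where
    open ≤-Reasoning
    M = t * (x + y)
    V = suc t * y
    split : suc t * M * V ^ t ≡ t * (suc t * x) * V ^ t + t * V ^ suc t
    split = solve 4 (λ t x y W → (con 1 :+ t) :* (t :* (x :+ y)) :* W
                                 := t :* ((con 1 :+ t) :* x) :* W :+ t :* (((con 1 :+ t) :* y) :* W)) refl t x y (V ^ t)

  tᵗ*maxFaces≤[m+t]ᵗ : ∀ t m → t ^ t * maxFaces t m ≤ (m + t) ^ t
  tᵗ*maxFaces≤[m+t]ᵗ zero    m = ≤-refl
  tᵗ*maxFaces≤[m+t]ᵗ (suc t) m with maxFaces-attained t m
  ... | Δ , Δ≤m , ≡joinCount = *-cancelˡ-≤ (t ^ t) {{n^n≢0 t}} (begin
    t ^ t * (suc t ^ suc t * maxFaces (suc t) m) ≡⟨ cong (λ z → t ^ t * (suc t ^ suc t * z)) ≡joinCount ⟩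
    t ^ t * (suc t ^ suc t * (x * maxFaces t Δ)) ≡⟨ solve 4 (λ T P x G → T :* (P :* (x :* G)) := P :* x :* (T :* G))
                                                        refl (t ^ t) (suc t ^ suc t) x (maxFaces t Δ) ⟩
    suc t ^ suc t * x * (t ^ t * maxFaces t Δ)   ≤⟨ *-monoʳ-≤ (suc t ^ suc t * x) (tᵗ*maxFaces≤[m+t]ᵗ t Δ) ⟩
    suc t ^ suc t * x * y ^ t                    ≤⟨ amgm t x y ⟩
    t ^ t * (x + y) ^ suc t                      ≡⟨ cong (λ z → t ^ t * z ^ suc t) x+y≡m+1+t ⟩
    t ^ t * (m + suc t) ^ suc t                  ∎)
    where
    open ≤-Reasoning
    x = suc (m ∸ Δ)
    y = Δ + t
    x+y≡m+1+t : x + y ≡ m + suc t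
    x+y≡m+1+t = trans (solve 3 (λ a Δ t → (con 1 :+ a) :+ (Δ :+ t) := (a :+ Δ) :+ (con 1 :+ t)) refl (m ∸ Δ) Δ t)
                      (cong (_+ suc t) (m∸n+n≡m Δ≤m))

  -- Δ = n − ⌊n/(t+1)⌋ splits n vertices as evenly as possible into t + 1 parts.
  balancedSplit : ∀ t n → ∃ λ Δ → Δ ≤ n × t * n ≤ suc t * Δ × n ≤ suc t * suc (n ∸ Δ)
  balancedSplit t n = Δ , Δ≤n , tn≤[1+t]Δ , n≤[1+t][1+n∸Δ]
    where
    q = n / suc t
    r = n % suc t
    r≤t : r ≤ t
    r≤t = ≤-pred (m%n<n n (suc t))
    n≡ : n ≡ r + q * suc t
    n≡ = m≡m%n+[m/n]*n n (suc t)
    Δ = t * q + r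
    Δ≤n : Δ ≤ n
    Δ≤n = begin
      t * q + r        ≤⟨ +-monoˡ-≤ r (*-monoˡ-≤ q (n≤1+n t)) ⟩
      suc t * q + r    ≡⟨ solve 3 (λ t q r → (con 1 :+ t) :* q :+ r := r :+ q :* (con 1 :+ t)) refl t q r ⟩
      r + q * suc t    ≡⟨ sym n≡ ⟩
      n                ∎
      where open ≤-Reasoning
    n∸Δ≡q : n ∸ Δ ≡ q
    n∸Δ≡q = trans (cong (_∸ Δ) (trans n≡ (solve 3 (λ t q r → r :+ q :* (con 1 :+ t) := q :+ (t :* q :+ r)) refl t q r)))
                  (m+n∸n≡m q Δ)
    tn≤[1+t]Δ : t * n ≤ suc t * Δ
    tn≤[1+t]Δ = begin
      t * n                         ≡⟨ cong (t *_) n≡ ⟩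
      t * (r + q * suc t)           ≡⟨ solve 3 (λ t q r → t :* (r :+ q :* (con 1 :+ t)) := t :* r :+ (con 1 :+ t) :* (t :* q)) refl t q r ⟩
      t * r + suc t * (t * q)       ≤⟨ +-monoˡ-≤ (suc t * (t * q)) (*-monoˡ-≤ r (n≤1+n t)) ⟩
      suc t * r + suc t * (t * q)   ≡⟨ solve 3 (λ t q r → (con 1 :+ t) :* r :+ (con 1 :+ t) :* (t :* q) := (con 1 :+ t) :* (t :* q :+ r)) refl t q r ⟩
      suc t * Δ                     ∎
      where open ≤-Reasoning
    n≤[1+t][1+n∸Δ] : n ≤ suc t * suc (n ∸ Δ)
    n≤[1+t][1+n∸Δ] = begin
      n                   ≡⟨ n≡ ⟩
      r + q * suc t       ≤⟨ +-monoˡ-≤ (q * suc t) (m≤n⇒m≤1+n r≤t) ⟩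
      suc t + q * suc t   ≡⟨ solve 2 (λ t q → (con 1 :+ t) :+ q :* (con 1 :+ t) := (con 1 :+ t) :* (con 1 :+ q)) refl t q ⟩
      suc t * suc q       ≡⟨ cong (λ z → suc t * suc z) (sym n∸Δ≡q) ⟩
      suc t * suc (n ∸ Δ) ∎
      where open ≤-Reasoning

  nᵗ≤tᵗ*maxFaces : ∀ t n → n ^ t ≤ t ^ t * maxFaces t n
  nᵗ≤tᵗ*maxFaces zero    n = ≤-refl
  nᵗ≤tᵗ*maxFaces (suc t) n with balancedSplit t n
  ... | Δ , Δ≤n , tn≤[1+t]Δ , n≤[1+t][1+n∸Δ] = *-cancelˡ-≤ (t ^ t) {{n^n≢0 t}} (begin
    t ^ t * n ^ suc t                                      ≡⟨ solve 3 (λ T n N → T :* (n :* N) := n :* (T :* N)) refl (t ^ t) n (n ^ t) ⟩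
    n * (t ^ t * n ^ t)                                    ≡⟨ cong (n *_) (sym ([m*n]^k≡m^k*n^k t n t)) ⟩
    n * (t * n) ^ t                                        ≤⟨ *-mono-≤ n≤[1+t][1+n∸Δ] (^-monoˡ-≤ t tn≤[1+t]Δ) ⟩
    (suc t * x) * (suc t * Δ) ^ t                          ≡⟨ cong (suc t * x *_) ([m*n]^k≡m^k*n^k (suc t) Δ t) ⟩
    (suc t * x) * (suc t ^ t * Δ ^ t)                      ≤⟨ *-monoʳ-≤ (suc t * x) (*-monoʳ-≤ (suc t ^ t) (nᵗ≤tᵗ*maxFaces t Δ)) ⟩
    (suc t * x) * (suc t ^ t * (t ^ t * maxFaces t Δ))      ≡⟨ solve 5 (λ t x P T G → ((con 1 :+ t) :* x) :* (P :* (T :* G))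
                                                                    := T :* (((con 1 :+ t) :* P) :* (x :* G))) refl t x (suc t ^ t) (t ^ t) (maxFaces t Δ) ⟩
    t ^ t * (suc t ^ suc t * joinCount (maxFaces t) n Δ)   ≤⟨ *-monoʳ-≤ (t ^ t) (*-monoʳ-≤ (suc t ^ suc t) (joinCount≤maxFaces t Δ≤n)) ⟩
    t ^ t * (suc t ^ suc t * maxFaces (suc t) n)           ∎)
    where
    open ≤-Reasoning
    x = suc (n ∸ Δ)

module Faces where

  open import Data.Nat using (ℕ; _+_; _≤_)
  open import Data.Nat.Properties hiding (_≟_)
  open import Data.Bool using (true)
  open import Data.Bool.Properties using () renaming (_≟_ to _≟ᵇ_)
  open import Data.Fin using (Fin; _≟_)
  open import Data.Fin.Subset
  open import Data.Fin.Subset.Properties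
  open import Data.Product using (_×_; _,_; proj₁; proj₂)
  open import Data.Sum using (_⊎_; inj₁; inj₂)
  open import Function using (_∘_)
  open import Relation.Nullary using (yes; no; ¬_; contradiction)
  open import Relation.Nullary.Decidable using (_×-dec_; ¬?)
  open import Relation.Unary using (Decidable)
  open import Relation.Binary.PropositionalEquality
  open import Defs using (Complex; edge; closed; numEdges)
  open Subsets
  open Counting
  open MaxFaces

  Face : ∀ {n} → Complex n → Subset n → Set
  Face H p = edge H p ≡ true

  face? : ∀ {n} (H : Complex n) → Decidable (Face H)
  face? H p = edge H p ≟ᵇ true

  face-⊆ : ∀ {n} (H : Complex n) {p q} → p ⊆ q → Face H q → Face H p
  face-⊆ H {p} {q} = closed H p q

  facesIn? : ∀ {n} (H : Complex n) (S : Subset n) → Decidable (λ p → p ⊆ S × Face H p)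
  facesIn? H S p = (p ⊆? S) ×-dec face? H p

  faces : ∀ {n} → Complex n → Subset n → ℕ
  faces H S = count (facesIn? H S)

  faces-mono : ∀ {n} (H : Complex n) {T S} → T ⊆ S → faces H T ≤ faces H S
  faces-mono H {T} {S} T⊆S = count-mono (facesIn? H T) (facesIn? H S) (λ _ (p⊆T , face) → T⊆S ∘ p⊆T , face)

  numEdges≡faces⊤ : ∀ {n} (H : Complex n) → numEdges H ≡ faces H ⊤
  numEdges≡faces⊤ H = trans (length-filter-allSubsets (face? H))
    (≤-antisym (count-mono (face? H) (facesIn? H ⊤) (λ _ face → ⊆⊤ , face))
               (count-mono (facesIn? H ⊤) (face? H) (λ _ → proj₂)))

  link : ∀ {n} → Complex n → Fin n → Complex n
  link H y = record
    { edge   = λ p → edge H (p ∪ ⁅ y ⁆)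
    ; closed = λ p q p⊆q → closed H _ _ (p⊆q⇒p∪r⊆q∪r ⁅ y ⁆ p⊆q)
    }

  Adjacent : ∀ {n} → Complex n → Subset n → Fin n → Fin n → Set
  Adjacent H S x y = y ∈ S × y ≢ x × Face H (pair x y)

  neighbourhood : ∀ {n} → Complex n → Subset n → Fin n → Subset n
  neighbourhood H S x = subsetOf (λ y → (y ∈? S) ×-dec (¬? (y ≟ x) ×-dec face? H (pair x y)))

  neighbourhood⁺ : ∀ {n} (H : Complex n) {S x y} → Adjacent H S x y → y ∈ neighbourhood H S x
  neighbourhood⁺ H {S} {x} = ∈-subsetOf⁺ (λ y → (y ∈? S) ×-dec (¬? (y ≟ x) ×-dec face? H (pair x y)))

  neighbourhood⁻ : ∀ {n} (H : Complex n) {S x y} → y ∈ neighbourhood H S x → Adjacent H S x y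
  neighbourhood⁻ H {S} {x} = ∈-subsetOf⁻ (λ y → (y ∈? S) ×-dec (¬? (y ≟ x) ×-dec face? H (pair x y)))

  neighbourhood⊆ : ∀ {n} (H : Complex n) {S x} → neighbourhood H S x ⊆ S
  neighbourhood⊆ H = proj₁ ∘ neighbourhood⁻ H

  neighbourhood-mono : ∀ {n} (H : Complex n) {T S} x → T ⊆ S → neighbourhood H T x ⊆ neighbourhood H S x
  neighbourhood-mono H x T⊆S y∈ with neighbourhood⁻ H y∈
  ... | y∈T , y≢x , face = neighbourhood⁺ H (T⊆S y∈T , y≢x , face)

  -- Faces of T containing y correspond, via toggling y, to faces of the link of y inside its neighbourhood.
  private
    module Split {n} (H : Complex n) {T : Subset n} {y : Fin n} (y∈T : y ∈ T) where

      N : Subset n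
      N = neighbourhood H T y

      LinkFace : Subset n → Set
      LinkFace p = toggle y p ⊆ N × Face H (toggle y p ∪ ⁅ y ⁆)

      linkFace? : Decidable LinkFace
      linkFace? p = facesIn? (link H y) N (toggle y p)

      count-linkFace : count linkFace? ≡ faces (link H y) N
      count-linkFace = count-toggle y (facesIn? (link H y) N)

      linkFace⇒y∈p : ∀ {p} → LinkFace p → y ∈ p
      linkFace⇒y∈p {p} (toggle⊆N , _) with y ∈? p
      ... | yes y∈p = y∈p
      ... | no y∉p  = contradiction refl (proj₁ (proj₂ (neighbourhood⁻ H (toggle⊆N (y∉p⇒y∈toggle y p y∉p)))))

      avoid-or-contain : ∀ p → p ⊆ T × Face H p → (p ⊆ T - y × Face H p) ⊎ LinkFace p
      avoid-or-contain p (p⊆T , face) with y ∈? p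
      ... | no y∉p  = inj₁ ((λ x∈p → x∈p∧x≢y⇒x∈p-y (p⊆T x∈p) λ { refl → y∉p x∈p }) , face)
      ... | yes y∈p = inj₂ (toggle⊆N , face-⊆ H toggle∪y⊆p face)
        where
        x≢y : ∀ {x} → x ∈ toggle y p → x ≢ y
        x≢y x∈ refl = y∈toggle⇒y∉p y p x∈ y∈p
        toggle⊆N : toggle y p ⊆ N
        toggle⊆N x∈ = let x∈p = x∈toggle⇒x∈p y p (x≢y x∈) x∈ in
          neighbourhood⁺ H (p⊆T x∈p , x≢y x∈ , face-⊆ H (pair⊆ y∈p x∈p) face)
        toggle∪y⊆p : toggle y p ∪ ⁅ y ⁆ ⊆ p
        toggle∪y⊆p x∈ with x∈p∪q⁻ (toggle y p) ⁅ y ⁆ x∈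
        ... | inj₁ x∈toggle = x∈toggle⇒x∈p y p (x≢y x∈toggle) x∈toggle
        ... | inj₂ x∈⁅y⁆    = subst (_∈ p) (sym (x∈⁅y⁆⇒x≡y y x∈⁅y⁆)) y∈p

      linkFace⇒face : ∀ p → LinkFace p → p ⊆ T × Face H p
      linkFace⇒face p (toggle⊆N , face) = p⊆T , face-⊆ H p⊆toggle∪y face
        where
        p⊆T : p ⊆ T
        p⊆T {x} x∈p with x ≟ y
        ... | yes refl = y∈T
        ... | no x≢y   = neighbourhood⊆ H (toggle⊆N (x∈p⇒x∈toggle y p x≢y x∈p))
        p⊆toggle∪y : p ⊆ toggle y p ∪ ⁅ y ⁆
        p⊆toggle∪y {x} x∈p with x ≟ y
        ... | yes refl = x∈p∪q⁺ (inj₂ (x∈⁅x⁆ y))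
        ... | no x≢y   = x∈p∪q⁺ (inj₁ (x∈p⇒x∈toggle y p x≢y x∈p))

      avoid⇒¬linkFace : ∀ p → p ⊆ T - y × Face H p → ¬ LinkFace p
      avoid⇒¬linkFace p (p⊆T-y , _) linkFace = x∈p─q⇒x∉q T ⁅ y ⁆ (p⊆T-y (linkFace⇒y∈p linkFace)) (x∈⁅x⁆ y)

      avoid⇒face : ∀ p → p ⊆ T - y × Face H p → p ⊆ T × Face H p
      avoid⇒face p (p⊆T-y , face) = p─q⊆p T ⁅ y ⁆ ∘ p⊆T-y , face

  faces-split : ∀ {n} (H : Complex n) {T y} → y ∈ T →
                faces H T ≡ faces H (T - y) + faces (link H y) (neighbourhood H T y)
  faces-split H {T} {y} y∈T = trans
    (≤-antisym (count-⊎ (facesIn? H T) (facesIn? H (T - y)) linkFace? avoid-or-contain)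
               (count-disjoint (facesIn? H T) (facesIn? H (T - y)) linkFace? avoid⇒face linkFace⇒face avoid⇒¬linkFace))
    (cong (faces H (T - y) +_) count-linkFace)
    where open Split H y∈T

module UpperBound where

  open import Data.Nat using (ℕ; zero; suc; _+_; _*_; _∸_; _≤_)
  open import Data.Nat.Properties hiding (_≟_)
  open import Data.Fin using (Fin; zero; suc)
  open import Data.Fin.Subset
  open import Data.Fin.Subset.Properties
  open import Data.Product using (∃; _×_; _,_; proj₁; proj₂)
  open import Data.Sum using (inj₁; inj₂)
  open import Function.Definitions using (Injective)
  open import Relation.Nullary using (yes; no; ¬_; contradiction)
  open import Relation.Binary.PropositionalEquality
  open import Defs using (Complex)
  open Subsets
  open Counting
  open MaxFaces
  open Faces

  CliqueFree : ∀ {n} → Complex n → Subset n → ℕ → Set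
  CliqueFree {n} H S k = (φ : Fin k → Fin n) → Injective _≡_ _≡_ φ → (∀ i → φ i ∈ S) →
                         ¬ (∀ i j → Face H (pair (φ i) (φ j)))

  cliqueFree-link : ∀ {n k} (H : Complex n) {S} y → CliqueFree H S k → CliqueFree (link H y) S k
  cliqueFree-link H y free φ φ-inj φ∈S clique =
    free φ φ-inj φ∈S (λ i j → face-⊆ H (p⊆p∪q ⁅ y ⁆) (clique i j))

  -- A k-clique in the neighbourhood of y extends by y to a (k+1)-clique.
  cliqueFree-neighbourhood : ∀ {n k} (H : Complex n) {S T y} → CliqueFree H S (suc (suc k)) →
                             y ∈ S → T ⊆ S → CliqueFree H (neighbourhood H T y) (suc k)
  cliqueFree-neighbourhood {n} {k} H {S} {T} {y} free y∈S T⊆S φ φ-inj φ∈N clique = free ψ ψ-inj ψ∈S ψ-clique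
    where
    adjacent : ∀ i → Adjacent H T y (φ i)
    adjacent i = neighbourhood⁻ H (φ∈N i)
    ψ : Fin (suc (suc k)) → Fin n
    ψ zero    = y
    ψ (suc i) = φ i
    ψ-inj : Injective _≡_ _≡_ ψ
    ψ-inj {zero}  {zero}  _    = refl
    ψ-inj {zero}  {suc j} y≡φj = contradiction (sym y≡φj) (proj₁ (proj₂ (adjacent j)))
    ψ-inj {suc i} {zero}  φi≡y = contradiction φi≡y (proj₁ (proj₂ (adjacent i)))
    ψ-inj {suc i} {suc j} φi≡φj = cong suc (φ-inj φi≡φj)
    ψ∈S : ∀ i → ψ i ∈ S
    ψ∈S zero    = y∈S
    ψ∈S (suc i) = T⊆S (proj₁ (adjacent i))
    edge-y : ∀ i → Face H (pair y (φ i))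
    edge-y i = proj₂ (proj₂ (adjacent i))
    ψ-clique : ∀ i j → Face H (pair (ψ i) (ψ j))
    ψ-clique zero    zero    = face-⊆ H (pair⊆ (x∈pair y (φ zero)) (x∈pair y (φ zero))) (edge-y zero)
    ψ-clique zero    (suc j) = edge-y j
    ψ-clique (suc i) zero    = face-⊆ H (pair⊆ (y∈pair y (φ i)) (x∈pair y (φ i))) (edge-y i)
    ψ-clique (suc i) (suc j) = clique i j

  -- Removing the vertices of T outside A one at a time, each costs at most the faces of its link.
  faces-peel : ∀ {n} (H : Complex n) {A b} k T → A ⊆ T → ∣ T ∣ ≤ ∣ A ∣ + k → faces H A ≤ b →
               (∀ {y} → y ∈ T → faces (link H y) (neighbourhood H T y) ≤ b) → faces H T ≤ suc k * b
  faces-peel H {A} {b} k T A⊆T ∣T∣≤ facesA≤b link≤b with p⊆q⊎∃p─q T A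
  ... | inj₁ T⊆A = ≤-trans (faces-mono H T⊆A) (≤-trans facesA≤b (m≤m+n b (k * b)))
  faces-peel H {A} zero T A⊆T ∣T∣≤ _ _ | inj₂ (y , y∈T , y∉A) =
    contradiction (≤-trans ∣T∣≤ (≤-reflexive (+-identityʳ ∣ A ∣))) (<⇒≱ (p⊂q⇒∣p∣<∣q∣ (A⊆T , y , y∈T , y∉A)))
  faces-peel H {A} {b} (suc k) T A⊆T ∣T∣≤ facesA≤b link≤b | inj₂ (y , y∈T , y∉A) = begin
    faces H T                                            ≡⟨ faces-split H y∈T ⟩
    faces H (T - y) + faces (link H y) (neighbourhood H T y)
                                                         ≤⟨ +-mono-≤ (faces-peel H k (T - y) A⊆T-y ∣T-y∣≤ facesA≤b link≤b′) (link≤b y∈T) ⟩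
    suc k * b + b                                        ≡⟨ +-comm (suc k * b) b ⟩
    suc (suc k) * b                                      ∎
    where
    open ≤-Reasoning
    A⊆T-y : A ⊆ T - y
    A⊆T-y x∈A = x∈p∧x≢y⇒x∈p-y (A⊆T x∈A) λ { refl → y∉A x∈A }
    ∣T-y∣≤ : ∣ T - y ∣ ≤ ∣ A ∣ + k
    ∣T-y∣≤ = ≤-pred (≤-trans (x∈p⇒∣p-x∣<∣p∣ y∈T) (≤-trans ∣T∣≤ (≤-reflexive (+-suc ∣ A ∣ k))))
    link≤b′ : ∀ {x} → x ∈ T - y → faces (link H x) (neighbourhood H (T - y) x) ≤ b
    link≤b′ {x} x∈ = ≤-trans (faces-mono (link H x) (neighbourhood-mono H x (p─q⊆p T ⁅ y ⁆))) (link≤b (p─q⊆p T ⁅ y ⁆ x∈))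

  -- The neighbourhood of a vertex of maximum degree, or ∅ when S is empty.
  maxDegreeNeighbourhood : ∀ {n k} (H : Complex n) {S} → CliqueFree H S (suc (suc k)) →
                           ∃ λ A → A ⊆ S × CliqueFree H A (suc k) × (∀ {y} → y ∈ S → ∣ neighbourhood H S y ∣ ≤ ∣ A ∣)
  maxDegreeNeighbourhood H {S} free with nonempty? S
  ... | no S-empty = ⊥ , ⊥⊆ , (λ _ _ φ∈⊥ _ → ∉⊥ (φ∈⊥ zero)) , λ y∈S → contradiction (_ , y∈S) S-empty
  ... | yes (v , v∈S) with argmaxOn (λ x → ∣ neighbourhood H S x ∣) S v∈S
  ...   | w , w∈S , max = neighbourhood H S w , neighbourhood⊆ H , cliqueFree-neighbourhood H free w∈S ⊆-refl , max

  faces≤maxFaces : ∀ t {n} (H : Complex n) {S} → CliqueFree H S (suc t) → faces H S ≤ maxFaces t ∣ S ∣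
  faces≤maxFaces zero H {S} free = count-≤1 (facesIn? H S) ⊥ (λ p (p⊆S , face) → Empty-unique (empty p⊆S face))
    where
    empty : ∀ {p} → p ⊆ S → Face H p → Empty p
    empty p⊆S face (x , x∈p) = free (λ _ → x) (λ { {zero} {zero} _ → refl }) (λ _ → p⊆S x∈p)
                                    (λ _ _ → face-⊆ H (pair⊆ x∈p x∈p) face)
  faces≤maxFaces (suc t) H {S} free with maxDegreeNeighbourhood H free
  ... | A , A⊆S , freeA , deg≤ = begin
    faces H S                                  ≤⟨ faces-peel H (∣ S ∣ ∸ ∣ A ∣) S A⊆S (≤-reflexive (sym (m+[n∸m]≡n ∣A∣≤∣S∣)))
                                                     (faces≤maxFaces t H freeA) link≤ ⟩
    joinCount (maxFaces t) (∣ S ∣) (∣ A ∣)     ≤⟨ joinCount≤maxFaces t ∣A∣≤∣S∣ ⟩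
    maxFaces (suc t) (∣ S ∣)                   ∎
    where
    open ≤-Reasoning
    ∣A∣≤∣S∣ : ∣ A ∣ ≤ ∣ S ∣
    ∣A∣≤∣S∣ = p⊆q⇒∣p∣≤∣q∣ A⊆S
    link≤ : ∀ {y} → y ∈ S → faces (link H y) (neighbourhood H S y) ≤ maxFaces t ∣ A ∣
    link≤ y∈S = ≤-trans (faces≤maxFaces t (link H _) (cliqueFree-link H _ (cliqueFree-neighbourhood H free y∈S ⊆-refl)))
                        (maxFaces-mono t (deg≤ y∈S))

module Construction where

  open import Data.Nat using (ℕ; zero; suc; _+_; _*_; _∸_; _≤_; z≤n; s≤s; _≤?_)
  open import Data.Nat.Properties hiding (_≟_)
  open import Data.Bool using (true)
  open import Data.Fin using (zero; punchIn)
  open import Data.Fin.Properties using (any?; punchIn-injective; punchInᵢ≢i)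
  open import Data.Fin.Subset
  open import Data.Fin.Subset.Properties
  open import Data.Product using (∃; _×_; _,_; proj₁; proj₂)
  open import Data.Sum using (inj₁; inj₂)
  open import Function using (_∘_)
  open import Relation.Nullary using (yes; no; ¬_; does; contradiction)
  open import Relation.Nullary.Decidable using (_×-dec_; ¬?; dec-true)
  open import Relation.Unary using (Decidable)
  open import Relation.Binary.PropositionalEquality hiding (J)
  open import Defs using (Complex; edge; closed)
  open Subsets
  open Counting
  open MaxFaces
  open Faces
  open UpperBound

  emptyComplex : ∀ {n} → Complex n
  emptyComplex = record
    { edge   = λ p → does (¬? (nonempty? p))
    ; closed = λ p q p⊆q q-empty → dec-true (¬? (nonempty? p))
                 λ { (x , x∈p) → does-true⁻ (¬? (nonempty? q)) q-empty (x , p⊆q x∈p) }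
    }

  -- The faces of the join of H (on X) with the independent set S ─ X.
  JoinFace : ∀ {n} → Complex n → Subset n → Subset n → Subset n → Set
  JoinFace H S X p = p ⊆ S × Face H (p ∩ X) × ∣ p ∩ (S ─ X) ∣ ≤ 1

  joinFace? : ∀ {n} (H : Complex n) S X → Decidable (JoinFace H S X)
  joinFace? H S X p = (p ⊆? S) ×-dec (face? H (p ∩ X) ×-dec (∣ p ∩ (S ─ X) ∣ ≤? 1))

  join : ∀ {n} → Complex n → Subset n → Subset n → Complex n
  join H S X = record { edge = does ∘ joinFace? H S X ; closed = closedJoin }
    where
    closedJoin : ∀ p q → p ⊆ q → does (joinFace? H S X q) ≡ true → does (joinFace? H S X p) ≡ true
    closedJoin p q p⊆q q-face with does-true⁻ (joinFace? H S X q) q-face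
    ... | q⊆S , trace , ∣q∩Y∣≤1 = dec-true (joinFace? H S X p)
      ( q⊆S ∘ p⊆q
      , face-⊆ H (p⊆q⇒p∩r⊆q∩r X p⊆q) trace
      , ≤-trans (p⊆q⇒∣p∣≤∣q∣ (p⊆q⇒p∩r⊆q∩r (S ─ X) p⊆q)) ∣q∩Y∣≤1 )

  module _ {n} (H : Complex n) (S X : Subset n) where

    join-face⁻ : ∀ {p} → Face (join H S X) p → JoinFace H S X p
    join-face⁻ {p} = does-true⁻ (joinFace? H S X p)

    join-face⁺ : ∀ {p q} → p ⊆ S → p ∩ X ⊆ q → Face H q → ∣ p ∩ (S ─ X) ∣ ≤ 1 → Face (join H S X) p
    join-face⁺ {p} p⊆S p∩X⊆q face ∣p∩Y∣≤1 = dec-true (joinFace? H S X p) (p⊆S , face-⊆ H p∩X⊆q face , ∣p∩Y∣≤1)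

    join-face-avoiding : ∀ {p} → Face (join H S X) p → (∀ {x} → x ∈ p → x ∉ S ─ X) → Face H p
    join-face-avoiding {p} face avoid with join-face⁻ face
    ... | p⊆S , trace , _ = face-⊆ H p⊆p∩X trace
      where
      p⊆p∩X : p ⊆ p ∩ X
      p⊆p∩X {x} x∈p with x ∈? X
      ... | yes x∈X = x∈p∩q⁺ (x∈p , x∈X)
      ... | no x∉X  = contradiction (x∈p∧x∉q⇒x∈p─q (p⊆S x∈p) x∉X) (avoid x∈p)

    join-independent : ∀ {x y} → x ≢ y → x ∈ S ─ X → y ∈ S ─ X → ¬ Face (join H S X) (pair x y)
    join-independent {x} {y} x≢y x∈Y y∈Y face =
      <⇒≱ (s≤s (s≤s z≤n)) (≤-trans (x≢y⇒2≤∣p∣ x≢y (x∈p∩q⁺ (x∈pair x y , x∈Y)) (x∈p∩q⁺ (y∈pair x y , y∈Y)))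
                                   (proj₂ (proj₂ (join-face⁻ {pair x y} face))))

    join-face-inner : X ⊆ S → ∀ {p} → p ⊆ X → Face H p → Face (join H S X) p
    join-face-inner X⊆S {p} p⊆X face =
      join-face⁺ (X⊆S ∘ p⊆X) (p∩q⊆p p X) face (≤-trans (p⊆q⇒∣p∣≤∣q∣ p∩Y⊆⊥) (≤-trans (≤-reflexive (∣⊥∣≡0 n)) z≤n))
      where
      p∩Y⊆⊥ : p ∩ (S ─ X) ⊆ ⊥
      p∩Y⊆⊥ x∈ with x∈p∩q⁻ p (S ─ X) x∈
      ... | x∈p , x∈Y = contradiction (p⊆X x∈p) (x∈p─q⇒x∉q S X x∈Y)

    join-face-cone : X ⊆ S → ∀ {p y} → y ∈ S → y ∉ X → p ⊆ X → Face H p → Face (join H S X) (p ∪ ⁅ y ⁆)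
    join-face-cone X⊆S {p} {y} y∈S y∉X p⊆X face =
      join-face⁺ p∪y⊆S trace⊆p face (≤-trans (p⊆q⇒∣p∣≤∣q∣ outside⊆y) (≤-reflexive (∣⁅x⁆∣≡1 y)))
      where
      p∪y⊆S : p ∪ ⁅ y ⁆ ⊆ S
      p∪y⊆S x∈ with x∈p∪q⁻ p ⁅ y ⁆ x∈
      ... | inj₁ x∈p   = X⊆S (p⊆X x∈p)
      ... | inj₂ x∈⁅y⁆ = subst (_∈ S) (sym (x∈⁅y⁆⇒x≡y y x∈⁅y⁆)) y∈S
      trace⊆p : (p ∪ ⁅ y ⁆) ∩ X ⊆ p
      trace⊆p x∈ with x∈p∩q⁻ (p ∪ ⁅ y ⁆) X x∈
      ... | x∈p∪y , x∈X with x∈p∪q⁻ p ⁅ y ⁆ x∈p∪y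
      ...   | inj₁ x∈p   = x∈p
      ...   | inj₂ x∈⁅y⁆ = contradiction (subst (_∈ X) (x∈⁅y⁆⇒x≡y y x∈⁅y⁆) x∈X) y∉X
      outside⊆y : (p ∪ ⁅ y ⁆) ∩ (S ─ X) ⊆ ⁅ y ⁆
      outside⊆y x∈ with x∈p∩q⁻ (p ∪ ⁅ y ⁆) (S ─ X) x∈
      ... | x∈p∪y , x∈Y with x∈p∪q⁻ p ⁅ y ⁆ x∈p∪y
      ...   | inj₁ x∈p   = contradiction (p⊆X x∈p) (x∈p─q⇒x∉q S X x∈Y)
      ...   | inj₂ x∈⁅y⁆ = x∈⁅y⁆

  -- A clique of the join meets S ─ X at most once; deleting that vertex leaves a clique of H.
  join-cliqueFree : ∀ {n k} (H : Complex n) S X → CliqueFree H ⊤ (suc k) → CliqueFree (join H S X) ⊤ (suc (suc k))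
  join-cliqueFree {k = k} H S X free φ φ-inj _ clique with outlier
    where
    outlier : ∃ λ i₀ → ∀ j → φ (punchIn i₀ j) ∉ S ─ X
    outlier with any? (λ i → φ i ∈? S ─ X)
    ... | yes (i , φi∈Y) = i , λ j φj∈Y →
            join-independent H S X (λ φi≡φj → punchInᵢ≢i i j (sym (φ-inj φi≡φj))) φi∈Y φj∈Y (clique i _)
    ... | no none        = zero , λ j φj∈Y → none (_ , φj∈Y)
  ... | i₀ , avoid = free (φ ∘ punchIn i₀) (punchIn-injective i₀ _ _ ∘ φ-inj) (λ _ → ∈⊤)
                          λ a b → join-face-avoiding H S X (clique _ _) (avoid-pair (avoid a) (avoid b))
    where
    avoid-pair : ∀ {x y z} → x ∉ S ─ X → y ∉ S ─ X → z ∈ pair x y → z ∉ S ─ X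
    avoid-pair x∉ y∉ z∈ with ∈pair⇒≡⊎≡ z∈
    ... | inj₁ refl = x∉
    ... | inj₂ refl = y∉

  faces-join : ∀ {n} (H : Complex n) {S X} → X ⊆ S → ∀ k T → X ⊆ T → T ⊆ S → ∣ X ∣ + k ≤ ∣ T ∣ →
               suc k * faces H X ≤ faces (join H S X) T
  faces-join H {S} {X} X⊆S zero T X⊆T T⊆S _ = begin
    1 * faces H X           ≡⟨ *-identityˡ (faces H X) ⟩
    faces H X               ≤⟨ count-mono (facesIn? H X) (facesIn? (join H S X) T)
                                 (λ p (p⊆X , face) → X⊆T ∘ p⊆X , join-face-inner H S X X⊆S p⊆X face) ⟩
    faces (join H S X) T    ∎
    where open ≤-Reasoning
  faces-join H {S} {X} X⊆S (suc k) T X⊆T T⊆S ∣X∣+1+k≤∣T∣ with p⊆q⊎∃p─q T X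
  ... | inj₁ T⊆X = contradiction (p⊆q⇒∣p∣≤∣q∣ T⊆X)
                     (<⇒≱ (≤-trans (s≤s (m≤m+n ∣ X ∣ k)) (≤-trans (≤-reflexive (sym (+-suc ∣ X ∣ k))) ∣X∣+1+k≤∣T∣)))
  ... | inj₂ (y , y∈T , y∉X) = begin
    suc (suc k) * faces H X                ≡⟨ +-comm (faces H X) (suc k * faces H X) ⟩
    suc k * faces H X + faces H X          ≤⟨ +-mono-≤ (faces-join H X⊆S k (T - y) X⊆T-y (T⊆S ∘ p─q⊆p T ⁅ y ⁆) ∣X∣+k≤∣T-y∣)
                                                       (count-mono (facesIn? H X) (facesIn? (link J y) N) cone) ⟩
    faces J (T - y) + faces (link J y) N   ≡⟨ sym (faces-split J y∈T) ⟩
    faces J T                              ∎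
    where
    open ≤-Reasoning
    J = join H S X
    N = neighbourhood J T y
    X⊆T-y : X ⊆ T - y
    X⊆T-y x∈X = x∈p∧x≢y⇒x∈p-y (X⊆T x∈X) λ { refl → y∉X x∈X }
    ∣X∣+k≤∣T-y∣ : ∣ X ∣ + k ≤ ∣ T - y ∣
    ∣X∣+k≤∣T-y∣ = ≤-pred (≤-trans (≤-reflexive (sym (+-suc ∣ X ∣ k)))
                                 (≤-trans ∣X∣+1+k≤∣T∣ (≤-reflexive (x∈p⇒∣p∣≡1+∣p-x∣ T y∈T))))
    cone : ∀ p → p ⊆ X × Face H p → p ⊆ N × Face J (p ∪ ⁅ y ⁆)
    cone p (p⊆X , face) = p⊆N , coneFace
      where
      coneFace : Face J (p ∪ ⁅ y ⁆)
      coneFace = join-face-cone H S X X⊆S (T⊆S y∈T) y∉X p⊆X face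
      p⊆N : p ⊆ N
      p⊆N x∈p = neighbourhood⁺ J (X⊆T (p⊆X x∈p) , (λ { refl → y∉X (p⊆X x∈p) }) ,
                  face-⊆ J (pair⊆ (x∈p∪q⁺ (inj₂ (x∈⁅x⁆ y))) (x∈p∪q⁺ (inj₁ x∈p))) coneFace)

  optimalPart : ∀ {n} t (S : Subset n) → ∃ λ X → X ⊆ S × maxFaces (suc t) ∣ S ∣ ≡ joinCount (maxFaces t) ∣ S ∣ ∣ X ∣
  optimalPart t S with maxFaces-attained t ∣ S ∣
  ... | Δ , Δ≤∣S∣ , ≡joinCount with subsetOfSize S Δ≤∣S∣
  ...   | X , X⊆S , ∣X∣≡Δ = X , X⊆S , trans ≡joinCount (cong (joinCount (maxFaces t) ∣ S ∣) (sym ∣X∣≡Δ))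

  -- Iterated joins realise the Turán graph's clique complex, with part sizes chosen optimally.
  turán : ∀ {n} → ℕ → Subset n → Complex n
  turán zero    S = emptyComplex
  turán (suc t) S = join (turán t X) S X
    where X = proj₁ (optimalPart t S)

  turán-cliqueFree : ∀ {n} t (S : Subset n) → CliqueFree (turán t S) ⊤ (suc t)
  turán-cliqueFree zero    S φ _ _ clique =
    does-true⁻ (¬? (nonempty? (pair (φ zero) (φ zero)))) (clique zero zero) (φ zero , x∈pair (φ zero) (φ zero))
  turán-cliqueFree (suc t) S = join-cliqueFree (turán t X) S X (turán-cliqueFree t X)
    where X = proj₁ (optimalPart t S)

  maxFaces≤faces-turán : ∀ {n} t (S : Subset n) → maxFaces t ∣ S ∣ ≤ faces (turán t S) S
  maxFaces≤faces-turán {n} zero S =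
    count-≥1 (facesIn? emptyComplex S) {⊥} (⊥⊆ , dec-true (¬? (nonempty? (⊥ {n}))) λ { (_ , x∈⊥) → ∉⊥ x∈⊥ })
  maxFaces≤faces-turán (suc t) S = begin
    maxFaces (suc t) ∣ S ∣                ≡⟨ proj₂ (proj₂ (optimalPart t S)) ⟩
    suc k * maxFaces t ∣ X ∣              ≤⟨ *-monoʳ-≤ (suc k) (maxFaces≤faces-turán t X) ⟩
    suc k * faces (turán t X) X           ≤⟨ faces-join (turán t X) X⊆S k S X⊆S ⊆-refl
                                                (≤-reflexive (m+[n∸m]≡n (p⊆q⇒∣p∣≤∣q∣ X⊆S))) ⟩
    faces (turán (suc t) S) S             ∎
    where
    open ≤-Reasoning
    X = proj₁ (optimalPart t S)
    X⊆S : X ⊆ S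
    X⊆S = proj₁ (proj₂ (optimalPart t S))
    k = ∣ S ∣ ∸ ∣ X ∣

module Extremal where

  open import Data.Nat using (suc; _≤_)
  open import Data.Nat.Properties using (≤-antisym; ≤⇒≤ᵇ; ≤ᵇ⇒≤)
  open import Data.Bool.Properties using (T-≡)
  open import Data.Fin using (Fin)
  open import Data.Fin.Subset using (⊤; _∈_; _⊆_; ∣_∣)
  open import Data.Fin.Subset.Properties using (∈⊤; ∣⊤∣≡n)
  open import Data.Product using (Σ; _×_; _,_; proj₁)
  open import Data.Sum using (inj₁; inj₂)
  open import Function.Bundles using (Equivalence)
  open import Relation.Nullary using (¬_)
  open import Relation.Binary.PropositionalEquality
  open import Defs
  open Subsets
  open MaxFaces
  open Faces
  open UpperBound
  open Construction

  contains⇒clique : ∀ {n} t (H : Complex n) → Contains H (K (suc t) 2) → ¬ CliqueFree H ⊤ (suc t)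
  contains⇒clique t H (φ , φ-inj , copy) free = free φ φ-inj (λ _ → ∈⊤) edges
    where
    edges : ∀ i j → Face H (pair (φ i) (φ j))
    edges i j = copy (pair i j) (Equivalence.to T-≡ (≤⇒≤ᵇ (∣pair∣≤2 i j))) (pair (φ i) (φ j)) image
      where
      image : IsImage φ (pair i j) (pair (φ i) (φ j))
      image x = preimage , λ _ → φ-pair
        where
        preimage : x ∈ pair (φ i) (φ j) → Σ (Fin (suc t)) λ k → k ∈ pair i j × φ k ≡ x
        preimage x∈ with ∈pair⇒≡⊎≡ x∈
        ... | inj₁ refl = i , x∈pair i j , refl
        ... | inj₂ refl = j , y∈pair i j , refl
        φ-pair : ∀ {k} → k ∈ pair i j → φ k ∈ pair (φ i) (φ j)
        φ-pair k∈ with ∈pair⇒≡⊎≡ k∈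
        ... | inj₁ refl = x∈pair (φ i) (φ j)
        ... | inj₂ refl = y∈pair (φ i) (φ j)

  -- Every face of K(t+1,2) lies in some pair, so a clique is a copy.
  ¬contains⇒cliqueFree : ∀ {n} t (H : Complex n) → ¬ Contains H (K (suc t) 2) → CliqueFree H ⊤ (suc t)
  ¬contains⇒cliqueFree t H ¬copy φ φ-inj _ clique = ¬copy (φ , φ-inj , copy)
    where
    copy : ∀ e → Face (K (suc t) 2) e → ∀ q → IsImage φ e q → Face H q
    copy e e-face q image with ∣p∣≤2⇒p⊆pair e (≤ᵇ⇒≤ ∣ e ∣ 2 (Equivalence.from T-≡ e-face))
    ... | i , j , e⊆pair = face-⊆ H q⊆pair (clique i j)
      where
      q⊆pair : q ⊆ pair (φ i) (φ j)
      q⊆pair {x} x∈q with proj₁ (image x) x∈q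
      ... | k , k∈e , refl with ∈pair⇒≡⊎≡ (e⊆pair k∈e)
      ...   | inj₁ refl = x∈pair (φ i) (φ j)
      ...   | inj₂ refl = y∈pair (φ i) (φ j)

  numEdges≤maxFaces : ∀ {n} t (H : Complex n) → ¬ Contains H (K (suc t) 2) → numEdges H ≤ maxFaces t n
  numEdges≤maxFaces {n} t H ¬copy = begin
    numEdges H           ≡⟨ numEdges≡faces⊤ H ⟩
    faces H ⊤            ≤⟨ faces≤maxFaces t H (¬contains⇒cliqueFree t H ¬copy) ⟩
    maxFaces t ∣ ⊤ {n} ∣ ≡⟨ cong (maxFaces t) (∣⊤∣≡n n) ⟩
    maxFaces t n         ∎
    where open Data.Nat.Properties.≤-Reasoning

  ex≡maxFaces : ∀ n t → IsEx n (K (suc t) 2) (maxFaces t n)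
  ex≡maxFaces n t = (turán t (⊤ {n}) , ¬copy , ≤-antisym (numEdges≤maxFaces t (turán t (⊤ {n})) ¬copy) lower) , numEdges≤maxFaces t
    where
    open Data.Nat.Properties.≤-Reasoning
    ¬copy : ¬ Contains (turán t (⊤ {n})) (K (suc t) 2)
    ¬copy copy = contains⇒clique t (turán t (⊤ {n})) copy (turán-cliqueFree t (⊤ {n}))
    lower : maxFaces t n ≤ numEdges (turán t (⊤ {n}))
    lower = begin
      maxFaces t n               ≡⟨ cong (maxFaces t) (sym (∣⊤∣≡n n)) ⟩
      maxFaces t ∣ ⊤ {n} ∣       ≤⟨ maxFaces≤faces-turán t (⊤ {n}) ⟩
      faces (turán t (⊤ {n})) ⊤        ≡⟨ sym (numEdges≡faces⊤ (turán t (⊤ {n}))) ⟩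
      numEdges (turán t (⊤ {n}))       ∎

module Asymptotics where

  open import Data.Nat using (ℕ; zero; suc; _+_; _*_; _∸_; _^_; _≤_; z≤n; _!; _≤ᵇ_; _≤?_; _/_)
  open import Data.Nat.Properties
  open import Data.Nat.Combinatorics using (_C_; nCk≡nPk/k!)
  open import Data.Nat.Combinatorics.Base using (_P′_; _P_)
  open import Data.Nat.Combinatorics.Specification using (k!∣nP′k; k>n⇒nCk≡0)
  open import Data.Nat.DivMod using (m*[n/m]≡n)
  open import Data.Bool using (true; false; T)
  open import Relation.Nullary using (yes; no; contradiction)
  open import Relation.Binary.PropositionalEquality
  open import Data.Nat.Solver using (module +-*-Solver)
  open +-*-Solver
  open Estimates using ([m*n]^k≡m^k*n^k)

  nPk≡nP′k : ∀ {n k} → k ≤ n → n P k ≡ n P′ k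
  nPk≡nP′k {n} {k} k≤n with k ≤ᵇ n in k≤ᵇn
  ... | true  = refl
  ... | false = contradiction (≤⇒≤ᵇ k≤n) (subst T k≤ᵇn)

  k!*nCk≡nP′k : ∀ {n k} → k ≤ n → k ! * (n C k) ≡ n P′ k
  k!*nCk≡nP′k {n} {k} k≤n = begin
    k ! * (n C k)                       ≡⟨ cong (k ! *_) (nCk≡nPk/k! k≤n) ⟩
    k ! * ((n P k) / k !) {{k !≢0}}     ≡⟨ cong (λ z → k ! * (z / k !) {{k !≢0}}) (nPk≡nP′k k≤n) ⟩
    k ! * ((n P′ k) / k !) {{k !≢0}}    ≡⟨ m*[n/m]≡n {{k !≢0}} (k!∣nP′k k≤n) ⟩
    n P′ k                              ∎
    where open ≡-Reasoning

  nP′k≤nᵏ : ∀ n k → n P′ k ≤ n ^ k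
  nP′k≤nᵏ n zero    = ≤-refl
  nP′k≤nᵏ n (suc k) = *-mono-≤ (m∸n≤m n k) (nP′k≤nᵏ n k)

  [n∸t]ᵏ≤nP′k : ∀ n {t k} → k ≤ t → (n ∸ t) ^ k ≤ n P′ k
  [n∸t]ᵏ≤nP′k n {k = zero}  _   = ≤-refl
  [n∸t]ᵏ≤nP′k n {k = suc k} k<t = *-mono-≤ (∸-monoʳ-≤ n (<⇒≤ k<t)) ([n∸t]ᵏ≤nP′k n (<⇒≤ k<t))

  t!*nCt≤nᵗ : ∀ n t → t ! * (n C t) ≤ n ^ t
  t!*nCt≤nᵗ n t with t ≤? n
  ... | yes t≤n = ≤-trans (≤-reflexive (k!*nCk≡nP′k t≤n)) (nP′k≤nᵏ n t)
  ... | no t≰n  = ≤-trans (≤-reflexive (trans (cong (t ! *_) (k>n⇒nCk≡0 (≰⇒> t≰n))) (*-zeroʳ (t !)))) z≤n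

  [k+c]ˢ⁺¹≤ : ∀ s k c → (k + c) ^ suc s ≤ k ^ suc s + suc s * c * (k + c) ^ s
  [k+c]ˢ⁺¹≤ zero k c = ≤-reflexive (solve 2 (λ k c → (k :+ c) :* con 1 := k :* con 1 :+ con 1 :* c :* con 1) refl k c)
  [k+c]ˢ⁺¹≤ (suc s) k c = begin
    (k + c) * ((k + c) * Q)                       ≤⟨ *-monoʳ-≤ (k + c) ([k+c]ˢ⁺¹≤ s k c) ⟩
    (k + c) * (A + suc s * c * Q)                 ≡⟨ solve 5 (λ k c A Q s → (k :+ c) :* (A :+ (con 1 :+ s) :* c :* Q)
                                                       := k :* A :+ c :* A :+ (con 1 :+ s) :* c :* ((k :+ c) :* Q)) refl k c A Q s ⟩
    k * A + c * A + suc s * c * ((k + c) * Q)     ≤⟨ +-monoˡ-≤ (suc s * c * ((k + c) * Q))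
                                                       (+-monoʳ-≤ (k * A) (*-monoʳ-≤ c (^-monoˡ-≤ (suc s) (m≤m+n k c)))) ⟩
    k * A + c * ((k + c) * Q) + suc s * c * ((k + c) * Q)
                                                  ≡⟨ solve 5 (λ k c A R s → k :* A :+ c :* R :+ (con 1 :+ s) :* c :* R
                                                       := k :* A :+ (con 2 :+ s) :* c :* R) refl k c A ((k + c) * Q) s ⟩
    k * A + suc (suc s) * c * ((k + c) * Q)       ∎
    where
    open ≤-Reasoning
    A = k ^ suc s
    Q = (k + c) ^ s

  threshold : ℕ → ℕ → ℕ
  threshold s q = q * suc s * (2 * suc s) * 2 ^ s + 2 * suc s

  q[k+2t]ᵗ≤[q+p]kᵗ : ∀ s q p k → 1 ≤ p → threshold s q ≤ k →
                     q * (k + 2 * suc s) ^ suc s ≤ (q + p) * k ^ suc s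
  q[k+2t]ᵗ≤[q+p]kᵗ s q p k 1≤p thr≤k = begin
    q * (k + c) ^ suc s                                      ≤⟨ *-monoʳ-≤ q ([k+c]ˢ⁺¹≤ s k c) ⟩
    q * (k ^ suc s + suc s * c * (k + c) ^ s)                ≤⟨ *-monoʳ-≤ q (+-monoʳ-≤ (k ^ suc s) (*-monoʳ-≤ (suc s * c) k+c≤2k)) ⟩
    q * (k ^ suc s + suc s * c * (2 ^ s * k ^ s))            ≡⟨ solve 6 (λ q K s c Z Ks → q :* (K :+ (con 1 :+ s) :* c :* (Z :* Ks))
                                                                  := q :* K :+ (q :* (con 1 :+ s) :* c :* Z) :* Ks)
                                                                  refl q (k ^ suc s) s c (2 ^ s) (k ^ s) ⟩
    q * k ^ suc s + (q * suc s * c * 2 ^ s) * k ^ s          ≤⟨ +-monoʳ-≤ (q * k ^ suc s) (*-monoˡ-≤ (k ^ s) (≤-trans (m≤m+n _ c) thr≤k)) ⟩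
    q * k ^ suc s + k ^ suc s                                ≤⟨ +-monoʳ-≤ (q * k ^ suc s) (≤-trans (≤-reflexive (sym (*-identityˡ (k ^ suc s))))
                                                                                                   (*-monoˡ-≤ (k ^ suc s) 1≤p)) ⟩
    q * k ^ suc s + p * k ^ suc s                            ≡⟨ sym (*-distribʳ-+ (k ^ suc s) q p) ⟩
    (q + p) * k ^ suc s                                      ∎
    where
    open ≤-Reasoning
    c = 2 * suc s
    k+c≤2k : (k + c) ^ s ≤ 2 ^ s * k ^ s
    k+c≤2k = ≤-trans (^-monoˡ-≤ s (≤-trans (+-monoʳ-≤ k (≤-trans (m≤n+m c _) thr≤k))
                                           (≤-reflexive (solve 1 (λ k → k :+ k := con 2 :* k) refl k))))
                     (≤-reflexive ([m*n]^k≡m^k*n^k 2 k s))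

  q[n+t]ᵗ≤[q+p]t!nCt : ∀ s q p n → 1 ≤ p → suc s + threshold s q ≤ n →
                       q * (n + suc s) ^ suc s ≤ (q + p) * (suc s ! * (n C suc s))
  q[n+t]ᵗ≤[q+p]t!nCt s q p n 1≤p n≥ = begin
    q * (n + t) ^ t                 ≡⟨ cong (λ z → q * z ^ t) n+t≡k+2t ⟩
    q * (k + 2 * t) ^ t             ≤⟨ q[k+2t]ᵗ≤[q+p]kᵗ s q p k 1≤p thr≤k ⟩
    (q + p) * k ^ t                 ≤⟨ *-monoʳ-≤ (q + p) ([n∸t]ᵏ≤nP′k n ≤-refl) ⟩
    (q + p) * (n P′ t)              ≡⟨ cong ((q + p) *_) (sym (k!*nCk≡nP′k t≤n)) ⟩
    (q + p) * (t ! * (n C t))       ∎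
    where
    open ≤-Reasoning
    t = suc s
    k = n ∸ t
    t≤n : t ≤ n
    t≤n = ≤-trans (m≤m+n t _) n≥
    thr≤k : threshold s q ≤ k
    thr≤k = ≤-trans (≤-reflexive (sym (m+n∸m≡n t (threshold s q)))) (∸-monoˡ-≤ t n≥)
    n+t≡k+2t : n + t ≡ k + 2 * t
    n+t≡k+2t = trans (cong (_+ t) (sym (m∸n+n≡m t≤n))) (solve 2 (λ k t → (k :+ t) :+ t := k :+ con 2 :* t) refl k t)

module Rationals where

  open import Data.Nat as ℕ using (ℕ; suc)
  import Data.Nat.Properties as ℕ
  import Data.Nat.Coprimality as Coprimality
  open import Data.Integer as ℤ using (+_; +≤+; +[1+_]; ∣_∣)
  import Data.Integer.Properties as ℤ
  open import Data.Rational using (ℚ; mkℚ; ↥_; ↧ₙ_; Positive; NonNegative; _≤_; _*_; _-_; _+_; _/_; 1ℚ; toℚᵘ)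
  import Data.Rational.Properties as ℚ
  import Data.Rational.Unnormalised as ℚᵘ
  import Data.Rational.Unnormalised.Properties as ℚᵘ
  open import Relation.Binary.PropositionalEquality

  toℚᵘ-n/1 : ∀ n → toℚᵘ (+ n / 1) ≡ ℚᵘ.mkℚᵘ (+ n) 0
  toℚᵘ-n/1 n = cong toℚᵘ (ℚ.normalize-coprime {n} {0} (Coprimality.sym (Coprimality.1-coprimeTo n)))

  1≤∣↥ε∣ : ∀ ε → Positive ε → 1 ℕ.≤ ∣ ↥ ε ∣
  1≤∣↥ε∣ (mkℚ +[1+ p ] _ _) _ = ℕ.s≤s ℕ.z≤n

  -- Writing ε = p/q, the bound Y ≤ (1 + ε) X is q Y ≤ (q + p) X.
  Y≤[1+ε]X : ∀ ε → Positive ε → ∀ X Y → ↧ₙ ε ℕ.* Y ℕ.≤ (↧ₙ ε ℕ.+ ∣ ↥ ε ∣) ℕ.* X →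
             + Y / 1 ≤ (1ℚ + ε) * (+ X / 1)
  Y≤[1+ε]X ε@(mkℚ (+ p) d _) _ X Y qY≤[q+p]X =
    ℚ.toℚᵘ-cancel-≤ (ℚᵘ.≤-respʳ-≃ (ℚᵘ.≃-sym toℚᵘ-rhs) (subst (ℚᵘ._≤ _) (sym (toℚᵘ-n/1 Y)) unnormalised))
    where
    toℚᵘ-rhs : toℚᵘ ((1ℚ + ε) * (+ X / 1)) ℚᵘ.≃ (ℚᵘ.mkℚᵘ (+ 1) 0 ℚᵘ.+ ℚᵘ.mkℚᵘ (+ p) d) ℚᵘ.* ℚᵘ.mkℚᵘ (+ X) 0
    toℚᵘ-rhs = ℚᵘ.≃-trans (ℚ.toℚᵘ-homo-* (1ℚ + ε) (+ X / 1))
                          (ℚᵘ.*-cong (ℚ.toℚᵘ-homo-+ 1ℚ ε) (ℚᵘ.≃-reflexive (toℚᵘ-n/1 X)))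
    lhs : + Y ℤ.* +[1+ ((d ℕ.+ 0 ℕ.* suc d) ℕ.* 1) ] ≡ + (suc d ℕ.* Y)
    lhs = trans (cong (λ z → + Y ℤ.* +[1+ z ]) (trans (ℕ.*-identityʳ _) (ℕ.+-identityʳ d)))
                (trans (sym (ℤ.pos-* Y (suc d))) (cong +_ (ℕ.*-comm Y (suc d))))
    rhs : ((+ 1 ℤ.* +[1+ d ] ℤ.+ + p ℤ.* + 1) ℤ.* + X) ℤ.* + 1 ≡ + ((suc d ℕ.+ p) ℕ.* X)
    rhs = trans (ℤ.*-identityʳ _)
         (trans (cong (λ z → (z ℤ.+ + p ℤ.* + 1) ℤ.* + X) (ℤ.*-identityˡ +[1+ d ]))
         (trans (cong (λ z → (+ suc d ℤ.+ z) ℤ.* + X) (ℤ.*-identityʳ (+ p)))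
         (trans (cong (ℤ._* + X) (sym (ℤ.pos-+ (suc d) p))) (sym (ℤ.pos-* (suc d ℕ.+ p) X)))))
    unnormalised : ℚᵘ.mkℚᵘ (+ Y) 0 ℚᵘ.≤ (ℚᵘ.mkℚᵘ (+ 1) 0 ℚᵘ.+ ℚᵘ.mkℚᵘ (+ p) d) ℚᵘ.* ℚᵘ.mkℚᵘ (+ X) 0
    unnormalised = ℚᵘ.*≤* (subst₂ ℤ._≤_ (sym lhs) (sym rhs) (+≤+ qY≤[q+p]X))

  [1-ε]X≤Y : ∀ ε → Positive ε → ∀ {X Y} → X ℕ.≤ Y → (1ℚ - ε) * (+ X / 1) ≤ + Y / 1
  [1-ε]X≤Y ε ε>0 {X} {Y} X≤Y = begin
    (1ℚ - ε) * (+ X / 1)   ≤⟨ ℚ.*-monoʳ-≤-nonNeg (+ X / 1) {{X≥0}} 1-ε≤1 ⟩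
    1ℚ * (+ X / 1)         ≡⟨ ℚ.*-identityˡ _ ⟩
    + X / 1                ≤⟨ ℚ.toℚᵘ-cancel-≤ (subst₂ ℚᵘ._≤_ (sym (toℚᵘ-n/1 X)) (sym (toℚᵘ-n/1 Y))
                                (ℚᵘ.*≤* (ℤ.*-monoʳ-≤-nonNeg (+ 1) (+≤+ X≤Y)))) ⟩
    + Y / 1                ∎
    where
    open ℚ.≤-Reasoning
    X≥0 : NonNegative (+ X / 1)
    X≥0 = subst ℚᵘ.NonNegative (sym (toℚᵘ-n/1 X)) _
    1-ε≤1 : 1ℚ - ε ≤ 1ℚ
    1-ε≤1 = ℚ.≤-trans (ℚ.+-monoʳ-≤ 1ℚ (ℚ.neg-antimono-≤ (ℚ.nonNegative⁻¹ ε {{ℚ.pos⇒nonNeg ε {{ε>0}}}})))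
                      (ℚ.≤-reflexive (ℚ.+-identityʳ 1ℚ))

open import Defs
open import Data.Nat using (ℕ; suc; _≥_; _!) renaming (_*_ to _*ₙ_; _^_ to _^ₙ_)
open import Data.Nat.Combinatorics using (_C_)
open import Data.Product using (Σ; _×_)
open import Data.Integer using (+_)
open import Data.Rational using (ℚ; Positive; _≤_; _*_; _-_; _+_; _/_; 1ℚ)

open import Data.Nat using () renaming (_+_ to _+ₙ_)
open import Data.Nat.Properties using (≤-trans; *-monoʳ-≤)
open import Data.Integer using (∣_∣)
open import Data.Rational using (↥_; ↧ₙ_)
open import Data.Product using (_,_)
open MaxFaces
open Estimates
open Extremal
open Asymptotics
open Rationals

-- The hypothesis t ≥ 3 is used only as t ≥ 1.
mainTheorem9 : ∀ (t : ℕ) → t ≥ 3 → ∀ (ε : ℚ) → Positive ε →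
    Σ ℕ λ n₀ → ∀ (n : ℕ) → n ≥ n₀ →
    Σ ℕ λ m → IsEx n (K (suc t) 2) m ×
    ((1ℚ - ε) * (+ (t ! *ₙ (n C t)) / 1) ≤ + (t ^ₙ t *ₙ m) / 1
    × + (t ^ₙ t *ₙ m) / 1 ≤ (1ℚ + ε) * (+ (t ! *ₙ (n C t)) / 1))
mainTheorem9 t@(suc s) _ ε ε>0 = t +ₙ threshold s q , λ n n≥n₀ →
  maxFaces t n , ex≡maxFaces n t ,
  [1-ε]X≤Y ε ε>0 (≤-trans (t!*nCt≤nᵗ n t) (nᵗ≤tᵗ*maxFaces t n)) ,
  Y≤[1+ε]X ε ε>0 _ _ (≤-trans (*-monoʳ-≤ q (tᵗ*maxFaces≤[m+t]ᵗ t n))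
                              (q[n+t]ᵗ≤[q+p]t!nCt s q p n (1≤∣↥ε∣ ε ε>0) n≥n₀))
  where
  q = ↧ₙ ε
  p = ∣ ↥ ε ∣
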